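{- Let $u<v$ in $W_{MN}$ with $\rho(v)-\rho(u)=2$, and fix a saturated chain $\kappa$ from $\hat 0$ to $u$. For each maximal chain $\gamma=(u\lessdot t\lessdot v)$ of $[u,v]$, let $(\lambda_1(\gamma),\lambda_2(\gamma))=(\Lambda_{\rho(u)+1}(c),\Lambda_{\rho(u)+2}(c))$, where $c$ is any maximal chain of $W_{MN}$ containing $\kappa$ and $\gamma$. Then one of the following holds: (1) if $[u,v]$ is isomorphic to $C_2\times C_2$, its two maximal chains $c_1,c_2$ have label pairs of the form $(l_1,l_2)$ and $(l_2,l_1)$ respectively, where $l_1,l_2$ are distinct letters of $\mathcal A\cup\mathcal X$; (2) if $[u,v]$ is isomorphic to $\Pi_3$, its three maximal chains $\gamma_1,\gamma_2,\gamma_3$ have label pairs of the form $(x_j,l)$, $(l,x_j)$ and $(x_j,x_j)$ respectively, for some $x_j\in\mathcal X$ and $l\in\mathcal A\cup(\mathcal X\setminus\{x_j\})$.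
   Context: Let $\mathcal A=\{a_1,\dots,a_M\}$ (lower alphabet) and $\mathcal X=\{x_1,\dots,x_N\}$ (upper alphabet) be disjoint sets. A shuffle word is a (possibly empty) word with distinct letters from $\mathcal A\cup\mathcal X$ such that the letters from $\mathcal A$ in it appear in increasing order of subscripts, and likewise those from $\mathcal X$. The poset of shuffles $W_{MN}$ is the set of shuffle words ordered by the reflexive-transitive closure of the covering relation $w\lessdot w'$ iff $w'$ is obtained from $w$ by deleting one letter of $\mathcal A$ or inserting one letter of $\mathcal X$ (the result being a shuffle word). It has minimum $\hat0=a_1\cdots a_M$, maximum $\hat1=x_1\cdots x_N$, rank function $\rho(w)=(M-\#(\text{letters of }\mathcal A\text{ in }w))+\#(\text{letters of }\mathcal X\text{ in }w)$, and maximal chains of length $M+N$. The labeling $\Lambda$: for a maximal chain $c=(\hat0=w^0\lessdot\cdots\lessdot w^{M+N}=\hat1)$ set $\Lambda(c)=(\Lambda_1(c),\dots,\Lambda_{M+N}(c))$, where for $0\le i<M+N$: (x) if $w^{i+1}$ is obtained from $w^i$ by inserting $x_k\in\mathcal X$, then $\Lambda_{i+1}(c)=x_k$; (xa) if $w^i=u\,x_k\,a_m\,v$ and $w^{i+1}=u\,x_k\,v$, and this is the first step along $c$ (from $\hat 0$) in which a letter located immediately after $x_k$ is deleted, then $\Lambda_{i+1}(c)=x_k$; (a) if $w^{i+1}$ is obtained by deleting $a_j\in\mathcal A$ and this is not of type (xa), then $\Lambda_{i+1}(c)=a_j$. By definition $\Lambda_k(c)$ depends only on $w^0,\dots,w^k$.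 $C_i$ denotes an $i$-element chain; $\Pi_3$ is the lattice of set partitions of a 3-element set (a minimum, a maximum and three pairwise incomparable middle elements). -}

module Defs where

open import Data.Nat using (ℕ; _+_; _∸_)
open import Data.Fin using (Fin) renaming (_<_ to _<F_; _≤_ to _≤F_)
open import Data.List using (List; []; _∷_; _++_; _∷ʳ_; [_]; map; mapMaybe; length; allFin)
open import Data.List.Relation.Unary.All using (All)
open import Data.List.Relation.Unary.Linked using (Linked)
open import Data.List.Relation.Unary.Unique.Propositional using (Unique)
open import Data.Maybe using (Maybe; just; nothing)
open import Data.Product using (Σ; ∃; _×_; _,_; proj₁)
open import Data.Sum using (_⊎_)
open import Relation.Binary.PropositionalEquality using (_≡_)
open import Relation.Binary.Construct.Closure.ReflexiveTransitive using (Star; ε; _◅_)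
open import Relation.Nullary using (¬_)

module Shuffle (M N : ℕ) where

  -- letters of A ∪ X : a m = a_{m+1}, x k = x_{k+1}
  data Letter : Set where
    a : Fin M → Letter
    x : Fin N → Letter

  Word : Set
  Word = List Letter

  aIdx : Letter → Maybe (Fin M)
  aIdx (a m) = just m
  aIdx (x _) = nothing

  xIdx : Letter → Maybe (Fin N)
  xIdx (a _) = nothing
  xIdx (x k) = just k

  record IsShuffle (w : Word) : Set where
    field
      distinct : Unique w
      a-incr   : Linked _<F_ (mapMaybe aIdx w)
      x-incr   : Linked _<F_ (mapMaybe xIdx w)

  Del : Word → Word → Set
  Del w w' = Σ Word λ u → Σ Word λ v → Σ (Fin M) λ m →
             (w ≡ u ++ a m ∷ v) × (w' ≡ u ++ v)

  Ins : Word → Word → Set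
  Ins w w' = Σ Word λ u → Σ Word λ v → Σ (Fin N) λ k →
             (w ≡ u ++ v) × (w' ≡ u ++ x k ∷ v)

  infix 4 _⋖_ _≤_
  _⋖_ : Word → Word → Set
  w ⋖ w' = IsShuffle w × IsShuffle w' × (Del w w' ⊎ Ins w w')

  -- the order: reflexive-transitive closure of ⋖ ; an element of  w ≤ w'
  -- is precisely a saturated chain from w to w'
  _≤_ : Word → Word → Set
  _≤_ = Star _⋖_

  0̂ : Word
  0̂ = map a (allFin M)

  1̂ : Word
  1̂ = map x (allFin N)

  countA countX : Word → ℕ
  countA w = length (mapMaybe aIdx w)
  countX w = length (mapMaybe xIdx w)

  ρ : Word → ℕ
  ρ w = (M ∸ countA w) + countX w

  -- the words w^0, ..., w^{k-1} of a chain w^0 ⋖ ... ⋖ w^k (endpoint excluded)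
  vertices : ∀ {w w'} → w ≤ w' → List Word
  vertices ε = []
  vertices {w} (_ ◅ s) = w ∷ vertices s

  steps : List Word → List (Word × Word)
  steps (p ∷ q ∷ r) = (p , q) ∷ steps (q ∷ r)
  steps _ = []

  DelAfter : Fin N → Word → Word → Set
  DelAfter k p q = Σ Word λ u → Σ Word λ v → Σ (Fin M) λ m →
                   (p ≡ u ++ x k ∷ a m ∷ v) × (q ≡ u ++ x k ∷ v)

  NoDelAfter : Fin N → List Word → Set
  NoDelAfter k ws = All (λ st → ¬ DelAfter k (proj₁ st) (Data.Product.proj₂ st)) (steps ws)

  TypeXA : List Word → Word → Word → Set
  TypeXA h w w' = Σ (Fin N) λ k → DelAfter k w w' × NoDelAfter k (h ∷ʳ w)

  -- the label Λ_{i+1} of the step w = w^i ⋖ w' = w^{i+1}, given the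
  -- earlier words h = (w^0, ..., w^{i-1})
  data HasLabel (h : List Word) (w w' : Word) : Letter → Set where
    lab-x  : ∀ k → Σ Word (λ u → Σ Word λ v → (w ≡ u ++ v) × (w' ≡ u ++ x k ∷ v)) →
             HasLabel h w w' (x k)
    lab-xa : ∀ k → DelAfter k w w' → NoDelAfter k (h ∷ʳ w) → HasLabel h w w' (x k)
    lab-a  : ∀ j → Σ Word (λ u → Σ Word λ v → (w ≡ u ++ a j ∷ v) × (w' ≡ u ++ v)) →
             ¬ TypeXA h w w' → HasLabel h w w' (a j)

  -- the maximal chain u ⋖ t ⋖ v of [u,v], placed after the earlier words h
  -- (h = vertices of κ), has label pair (l₁ , l₂)
  LabelPair : List Word → Word → Word → Word → Letter → Letter → Set
  LabelPair h u t v l₁ l₂ = HasLabel h u t l₁ × HasLabel (h ∷ʳ u) t v l₂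

  Mid : Word → Word → Word → Set
  Mid u v t = (u ⋖ t) × (t ⋖ v)

  Interval : Word → Word → Set
  Interval u v = Σ Word λ w → (u ≤ w) × (w ≤ v)

  record IntervalIso (u v : Word) (P : Set) (_⊑_ : P → P → Set) : Set where
    field
      to      : Interval u v → P
      from    : P → Interval u v
      from-to : ∀ p → proj₁ (from (to p)) ≡ proj₁ p
      to-from : ∀ q → to (from q) ≡ q
      to-mono : ∀ p q → proj₁ p ≤ proj₁ q → to p ⊑ to q
      to-refl : ∀ p q → to p ⊑ to q → proj₁ p ≤ proj₁ q

C₂×C₂ : Set
C₂×C₂ = Fin 2 × Fin 2

_⊑₂₂_ : C₂×C₂ → C₂×C₂ → Set
(i , j) ⊑₂₂ (i' , j') = (i ≤F i') × (j ≤F j')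

data Π₃ : Set where
  bot : Π₃
  mid : Fin 3 → Π₃
  top : Π₃

data _⊑Π_ : Π₃ → Π₃ → Set where
  bot⊑ : ∀ {p} → bot ⊑Π p
  ⊑top : ∀ {p} → p ⊑Π top
  mid⊑ : ∀ {i} → mid i ⊑Π mid i

{-# OPTIONS --safe #-}
-- Each covering step raises ρ by one, so every chain from u to v is u ⋖ t ⋖ v, and [u,v]
-- consists of u, v and pairwise incomparable middle elements t: it is C₂ × C₂ or Π₃ according
-- as there are two or three of them.  Going from u to v inserts two letters xₖ₁, xₖ₂, or deletes
-- two letters aₘ₁, aₘ₂, or deletes one aₘ and inserts one xₖ.  In the first two cases the middle
-- elements come from making one of the two changes first, and the two chains carry swapped
-- labels: a deletion is labelled by the xₖ just before it if nothing has yet been deleted right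
-- after that xₖ, and by the deleted letter otherwise, and the other change does not affect this.
-- In the mixed case the middle elements are u without aₘ and the words obtained by inserting xₖ
-- into u as it stands in v.  The latter is unique unless xₖ takes the place of aₘ (u = P aₘ S,
-- v = P xₖ S), when it can go on either side of aₘ; then [u,v] ≅ Π₃, and on the chain through
-- P xₖ aₘ S the deletion of aₘ is labelled xₖ, as xₖ is new and nothing was ever deleted after it.
module Submission where

open import Defs
open import Data.Nat using (ℕ; zero; suc; _+_; _∸_; z≤n; s≤s) renaming (_≤_ to _≤ℕ_; _<_ to _<ℕ_)
open import Data.Nat.Properties
  using ( +-suc; +-comm; +-assoc; +-cancelʳ-≡; +-∸-assoc; +-monoʳ-≤; ≤-trans; ≤-reflexive; m≤m+n; m≤n+m
        ; 1+n≰n; m+1+n≢0; m≢1+n+m; m+1+n≢m; m+1+n≰m; suc-injective; module ≤-Reasoning)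
open import Data.Fin using (Fin; zero; suc; toℕ; _≟_) renaming (_<_ to _<ᶠ_)
open import Data.Fin.Properties using (toℕ<n; ≤fromℕ) renaming (<-trans to <ᶠ-trans; ≤-refl to ≤ᶠ-refl)
open import Data.List using (List; []; _∷_; _++_; _∷ʳ_; [_]; length; map; mapMaybe; catMaybes; last)
open import Data.List.Properties
  using ( ++-assoc; ++-cancelˡ; ∷-injective; ∷-injectiveˡ; ∷-injectiveʳ; map-++; catMaybes-++
        ; ++-identityʳ; ++-identityʳ-unique; ++-conicalˡ; ++-conicalʳ; ≡-dec)
open import Data.List.Relation.Unary.All using (All; []; _∷_; all?)
open import Data.List.Relation.Unary.All.Properties using (++⁺; ++⁻; All¬⇒¬Any; ¬Any⇒All¬)
open import Data.List.Relation.Unary.Any using (here; there)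
open import Data.List.Relation.Unary.AllPairs using ([]; _∷_)
open import Data.List.Relation.Unary.Linked using (Linked; []; [-]; _∷_)
open import Data.List.Relation.Unary.Unique.Propositional using (Unique)
open import Data.List.Membership.Propositional using (_∈_; _∉_)
open import Data.List.Membership.Propositional.Properties using (∈-insert; ∈-++⁺ˡ; ∈-++⁺ʳ)
open import Data.Maybe using (Maybe; just; nothing; maybe′)
open import Data.Maybe.Properties using (just-injective)
open import Data.Product using (Σ; ∃; ∃₂; _×_; _,_; proj₁; proj₂)
open import Data.Sum using (_⊎_; inj₁; inj₂)
import Data.Sum as Sum
open import Function using (_∘_; id)
open import Relation.Nullary using (¬_; Dec; yes; no; ¬?; contradiction)
open import Relation.Nullary.Decidable using (map′)
open import Relation.Binary.Definitions using (Transitive; DecidableEquality)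
open import Relation.Binary.PropositionalEquality
  using (_≡_; _≢_; refl; sym; trans; cong; cong₂; subst; subst₂; module ≡-Reasoning)
open import Relation.Binary.Construct.Closure.ReflexiveTransitive using (ε; _◅_)

-- Lists with a spliced-in element

module _ {A : Set} where

  length-splice : ∀ (p : List A) {c q} → length (p ++ c ∷ q) ≡ suc (length (p ++ q))
  length-splice []      = refl
  length-splice (_ ∷ p) = cong suc (length-splice p)

  ∈-splice⁺ : ∀ (p : List A) {c d q} → d ∈ p ++ q → d ∈ p ++ c ∷ q
  ∈-splice⁺ []      d∈q         = there d∈q
  ∈-splice⁺ (_ ∷ p) (here d≡)   = here d≡
  ∈-splice⁺ (_ ∷ p) (there d∈)  = there (∈-splice⁺ p d∈)

  ∈-splice⁻ : ∀ (p : List A) {c d q} → d ∈ p ++ c ∷ q → d ≢ c → d ∈ p ++ q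
  ∈-splice⁻ []      (here d≡c)  d≢c = contradiction d≡c d≢c
  ∈-splice⁻ []      (there d∈q) _   = d∈q
  ∈-splice⁻ (_ ∷ p) (here d≡)   _   = here d≡
  ∈-splice⁻ (_ ∷ p) (there d∈)  d≢c = there (∈-splice⁻ p d∈ d≢c)

  All-splice⁻ : ∀ {P : A → Set} (p : List A) {c q} → All P (p ++ c ∷ q) → All P (p ++ q)
  All-splice⁻ p all with ++⁻ p all
  ... | all-p , _ ∷ all-q = ++⁺ all-p all-q

  All-splice⁺ : ∀ {P : A → Set} (p : List A) {c q} → All P (p ++ q) → P c → All P (p ++ c ∷ q)
  All-splice⁺ p all Pc with ++⁻ p all
  ... | all-p , all-q = ++⁺ all-p (Pc ∷ all-q)

  Unique-splice⇒∉ : ∀ (p : List A) {c q} → Unique (p ++ c ∷ q) → c ∉ p ++ q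
  Unique-splice⇒∉ []      (c∉q ∷ _) = All¬⇒¬Any c∉q
  Unique-splice⇒∉ (y ∷ p) (y∉ ∷ _)  (here c≡y) =
    All¬⇒¬Any y∉ (subst (_∈ p ++ _ ∷ _) c≡y (∈-insert p))
  Unique-splice⇒∉ (y ∷ p) (_ ∷ uniq) (there c∈) = Unique-splice⇒∉ p uniq c∈

  Unique-splice⁻ : ∀ (p : List A) {c q} → Unique (p ++ c ∷ q) → Unique (p ++ q)
  Unique-splice⁻ []      (_ ∷ uniq)   = uniq
  Unique-splice⁻ (_ ∷ p) (y∉ ∷ uniq) = All-splice⁻ p y∉ ∷ Unique-splice⁻ p uniq

  Unique-splice⁺ : ∀ (p : List A) {c q} → Unique (p ++ q) → c ∉ p ++ q → Unique (p ++ c ∷ q)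
  Unique-splice⁺ []      uniq         c∉ = ¬Any⇒All¬ _ c∉ ∷ uniq
  Unique-splice⁺ (y ∷ p) (y∉ ∷ uniq) c∉ =
    All-splice⁺ p y∉ (λ y≡c → c∉ (here (sym y≡c))) ∷ Unique-splice⁺ p uniq (c∉ ∘ there)

  Unique-++⇒disjoint : ∀ (p : List A) {q c} → Unique (p ++ q) → c ∈ p → c ∉ q
  Unique-++⇒disjoint (_ ∷ p) (y∉ ∷ _)   (here refl) c∈q = All¬⇒¬Any y∉ (∈-++⁺ʳ p c∈q)
  Unique-++⇒disjoint (_ ∷ p) (_ ∷ uniq) (there c∈p) c∈q = Unique-++⇒disjoint p uniq c∈p c∈q

  splice-injective : ∀ (p p' : List A) {c q q'} → Unique (p ++ c ∷ q) →
                     p ++ c ∷ q ≡ p' ++ c ∷ q' → p ≡ p' × q ≡ q'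
  splice-injective []      []       _          refl = refl , refl
  splice-injective []      (y ∷ p') (c∉ ∷ _)   eq with refl , eq′ ← ∷-injective eq =
    contradiction (subst (_ ∈_) (sym eq′) (∈-insert p')) (All¬⇒¬Any c∉)
  splice-injective (y ∷ p) []       (c∉ ∷ _)   eq with refl , _ ← ∷-injective eq =
    contradiction (∈-insert p) (All¬⇒¬Any c∉)
  splice-injective (y ∷ p) (y′ ∷ p') (_ ∷ uniq) eq with refl , eq′ ← ∷-injective eq
    with refl , refl ← splice-injective p p' uniq eq′ = refl , refl

  deleted-unique : ∀ (p p' : List A) {c c' q q'} → Unique (p ++ c ∷ q) →
                   p ++ c ∷ q ≡ p' ++ c' ∷ q' → p ++ q ≡ p' ++ q' → p ≡ p' × c ≡ c' × q ≡ q'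
  deleted-unique []      []       _         refl _ = refl , refl , refl
  deleted-unique []      (y ∷ p') (c∉ ∷ _)  eq eq′ with refl , _ ← ∷-injective eq =
    contradiction (subst (_ ∈_) (sym eq′) (here refl)) (All¬⇒¬Any c∉)
  deleted-unique (y ∷ p) []       (y∉ ∷ _)  eq eq′ with refl , eq″ ← ∷-injective eq =
    contradiction (subst (_ ∈_) (sym eq″) (subst (_ ∈_) eq′ (here refl))) (All¬⇒¬Any y∉)
  deleted-unique (y ∷ p) (y′ ∷ p') (_ ∷ uniq) eq eq′ with refl , eq″ ← ∷-injective eq
    with refl , rest ← deleted-unique p p' uniq eq″ (∷-injectiveʳ eq′) = refl , rest

  ∈-splice₂⁺ : ∀ (p m : List A) {c d e q} → e ∈ p ++ m ++ q → e ∈ p ++ c ∷ m ++ d ∷ q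
  ∈-splice₂⁺ p m {q = q} e∈ =
    ∈-splice⁺ p (subst (_ ∈_) (++-assoc p m _) (∈-splice⁺ (p ++ m) (subst (_ ∈_) (sym (++-assoc p m q)) e∈)))

  ∈-splice₂⁻ : ∀ (p m : List A) {c d e q} → e ∈ p ++ c ∷ m ++ d ∷ q → e ≢ c → e ≢ d → e ∈ p ++ m ++ q
  ∈-splice₂⁻ p m {q = q} e∈ e≢c e≢d =
    subst (_ ∈_) (++-assoc p m q) (∈-splice⁻ (p ++ m) (subst (_ ∈_) (sym (++-assoc p m _)) (∈-splice⁻ p e∈ e≢c)) e≢d)

  spliced-∈ : ∀ {w} (p : List A) {c q} → w ≡ p ++ c ∷ q → c ∈ w
  spliced-∈ p refl = ∈-insert p

  removed-∉ : ∀ {w w'} (p : List A) {c q} → Unique w → w ≡ p ++ c ∷ q → w' ≡ p ++ q → c ∉ w'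
  removed-∉ p uniq refl refl = Unique-splice⇒∉ p uniq

  splice-position : ∀ {w} (p p' : List A) {c q q'} → Unique w → w ≡ p ++ c ∷ q → w ≡ p' ++ c ∷ q' → p ≡ p' × q ≡ q'
  splice-position p p' uniq refl w≡ = splice-injective p p' uniq w≡

  removed-unique : ∀ {w t t'} (p p' : List A) {c q q'} → Unique w →
                   w ≡ p ++ c ∷ q → t ≡ p ++ q → w ≡ p' ++ c ∷ q' → t' ≡ p' ++ q' → t ≡ t'
  removed-unique p p' uniq w≡ refl w≡′ refl with refl , refl ← splice-position p p' uniq w≡ w≡′ = refl

  ∈-spliced⁺ : ∀ {w w'} (p : List A) {c d q} → w ≡ p ++ q → w' ≡ p ++ c ∷ q → d ∈ w → d ∈ w'
  ∈-spliced⁺ p refl refl = ∈-splice⁺ p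

  ∈-spliced⁻ : ∀ {w w'} (p : List A) {c d q} → w ≡ p ++ c ∷ q → w' ≡ p ++ q → d ∈ w → d ≢ c → d ∈ w'
  ∈-spliced⁻ p refl refl = ∈-splice⁻ p

  reassoc : ∀ {w} (p m : List A) {q} → w ≡ p ++ m ++ q → w ≡ (p ++ m) ++ q
  reassoc p m w≡ = trans w≡ (sym (++-assoc p m _))

  ++-equidivisible : ∀ (p q r s : List A) → p ++ q ≡ r ++ s →
                     (∃ λ m → r ≡ p ++ m × q ≡ m ++ s) ⊎ (∃ λ m → p ≡ r ++ m × s ≡ m ++ q)
  ++-equidivisible []      q r        s eq = inj₁ (r , refl , eq)
  ++-equidivisible (y ∷ p) q []       s eq = inj₂ (y ∷ p , refl , sym eq)
  ++-equidivisible (y ∷ p) q (y′ ∷ r) s eq with refl , eq′ ← ∷-injective eq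
    with ++-equidivisible p q r s eq′
  ... | inj₁ (m , r≡ , q≡) = inj₁ (m , cong (y ∷_) r≡ , q≡)
  ... | inj₂ (m , p≡ , s≡) = inj₂ (m , cong (y ∷_) p≡ , s≡)

  splice-order : ∀ (p q p' q' : List A) {c d} → p ++ c ∷ q ≡ p' ++ d ∷ q' → c ≢ d →
                 (∃ λ m → p' ≡ p ++ c ∷ m × q ≡ m ++ d ∷ q') ⊎ (∃ λ m → p ≡ p' ++ d ∷ m × q' ≡ m ++ c ∷ q)
  splice-order p q p' q' eq c≢d with ++-equidivisible p _ p' _ eq
  ... | inj₁ ([] , _ , eq′)     = contradiction (proj₁ (∷-injective eq′)) c≢d
  ... | inj₁ (_ ∷ m , p'≡ , eq′) with refl , q≡ ← ∷-injective eq′ = inj₁ (m , p'≡ , q≡)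
  ... | inj₂ ([] , _ , eq′)     = contradiction (sym (proj₁ (∷-injective eq′))) c≢d
  ... | inj₂ (_ ∷ m , p≡ , eq′) with refl , q'≡ ← ∷-injective eq′ = inj₂ (m , p≡ , q'≡)

  last-++-∷ : ∀ (p : List A) {d w} → last (p ++ d ∷ w) ≡ last (d ∷ w)
  last-++-∷ []           = refl
  last-++-∷ (_ ∷ [])     = refl
  last-++-∷ (_ ∷ c ∷ p)  = last-++-∷ (c ∷ p)

  last≡just⇒∷ʳ : ∀ (p : List A) {d} → last p ≡ just d → ∃ λ p' → p ≡ p' ∷ʳ d
  last≡just⇒∷ʳ (_ ∷ [])    refl = [] , refl
  last≡just⇒∷ʳ (c ∷ c' ∷ p) eq with p' , p≡ ← last≡just⇒∷ʳ (c' ∷ p) eq = c ∷ p' , cong (c ∷_) p≡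

  last≡just⇒∈ : ∀ (p : List A) {d} → last p ≡ just d → d ∈ p
  last≡just⇒∈ p eq with p' , refl ← last≡just⇒∷ʳ p eq = ∈-insert p'

module _ {A B : Set} (f : A → Maybe B) where

  mapMaybe-++ : ∀ xs ys → mapMaybe f (xs ++ ys) ≡ mapMaybe f xs ++ mapMaybe f ys
  mapMaybe-++ xs ys = trans (cong catMaybes (map-++ f xs ys)) (catMaybes-++ (map f xs) (map f ys))

  mapMaybe-splice-nothing : ∀ xs {c ys} → f c ≡ nothing → mapMaybe f (xs ++ c ∷ ys) ≡ mapMaybe f (xs ++ ys)
  mapMaybe-splice-nothing []       {ys = ys} fc = cong (λ z → maybe′ _∷_ id z (mapMaybe f ys)) fc
  mapMaybe-splice-nothing (y ∷ xs) fc = cong (maybe′ _∷_ id (f y)) (mapMaybe-splice-nothing xs fc)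

  length-mapMaybe-splice-just : ∀ xs {c b ys} → f c ≡ just b →
                                length (mapMaybe f (xs ++ c ∷ ys)) ≡ suc (length (mapMaybe f (xs ++ ys)))
  length-mapMaybe-splice-just []       {ys = ys} fc = cong (λ z → length (maybe′ _∷_ id z (mapMaybe f ys))) fc
  length-mapMaybe-splice-just (y ∷ xs) fc with f y
  ... | just _  = cong suc (length-mapMaybe-splice-just xs fc)
  ... | nothing = length-mapMaybe-splice-just xs fc

  Linked-mapMaybe-splice⁻ : ∀ {R : B → B → Set} → Transitive R → ∀ xs {c ys} →
                            Linked R (mapMaybe f (xs ++ c ∷ ys)) → Linked R (mapMaybe f (xs ++ ys))
  Linked-mapMaybe-splice⁻ {R} R-trans xs {c} {ys} linked
    rewrite mapMaybe-++ xs (c ∷ ys) | mapMaybe-++ xs ys with f c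
  ... | nothing = linked
  ... | just _  = Linked-splice⁻ (mapMaybe f xs) linked
    where
    Linked-splice⁻ : ∀ zs {y ys} → Linked R (zs ++ y ∷ ys) → Linked R (zs ++ ys)
    Linked-splice⁻ []            {ys = []}    _            = []
    Linked-splice⁻ []            {ys = _ ∷ _} (_ ∷ l)      = l
    Linked-splice⁻ (_ ∷ [])      {ys = []}    _            = [-]
    Linked-splice⁻ (_ ∷ [])      {ys = _ ∷ _} (r ∷ r′ ∷ l) = R-trans r r′ ∷ l
    Linked-splice⁻ (_ ∷ z ∷ zs)               (r ∷ l)      = r ∷ Linked-splice⁻ (z ∷ zs) l

Linked-<-length≤ : ∀ {n} (is : List (Fin n)) → Linked _<ᶠ_ is → length is ≤ℕ n
Linked-<-length≤ []       _      = z≤n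
Linked-<-length≤ (i ∷ is) linked = ≤-trans (s≤s (m≤m+n (length is) (toℕ i))) (bound i is linked)
  where
  open ≤-Reasoning
  bound : ∀ {n} (i : Fin n) is → Linked _<ᶠ_ (i ∷ is) → length is + toℕ i <ℕ n
  bound i []       _              = toℕ<n i
  bound i (j ∷ is) (i<j ∷ linked) = begin-strict
    suc (length is) + toℕ i  ≡⟨ +-suc (length is) (toℕ i) ⟨
    length is + suc (toℕ i)  ≤⟨ +-monoʳ-≤ (length is) i<j ⟩
    length is + toℕ j        <⟨ bound j is linked ⟩
    _                        ∎

-- Bounded posets of height two

data Height (I : Set) : Set where
  ⊥ₕ ⊤ₕ : Height I
  atom  : I → Height I

data _≼_ {I : Set} : Height I → Height I → Set where
  ⊥≼        : ∀ {h} → ⊥ₕ ≼ h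
  ≼⊤        : ∀ {h} → h ≼ ⊤ₕ
  atom≼atom : ∀ {i} → atom i ≼ atom i

record OrderIso {P Q : Set} (_⊑_ : P → P → Set) (_≤Q_ : Q → Q → Set) : Set where
  field
    to         : P → Q
    from       : Q → P
    from∘to    : ∀ p → from (to p) ≡ p
    to∘from    : ∀ q → to (from q) ≡ q
    to-mono    : ∀ {p p'} → p ⊑ p' → to p ≤Q to p'
    to-reflect : ∀ {p p'} → to p ≤Q to p' → p ⊑ p'

Height₂≅C₂×C₂ : OrderIso (_≼_ {Fin 2}) _⊑₂₂_
Height₂≅C₂×C₂ = record
  { to = to ; from = from ; from∘to = from∘to ; to∘from = to∘from
  ; to-mono = to-mono ; to-reflect = to-reflect _ _ }
  where
  to : Height (Fin 2) → C₂×C₂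
  to ⊥ₕ                = zero , zero
  to (atom zero)       = suc zero , zero
  to (atom (suc zero)) = zero , suc zero
  to ⊤ₕ                = suc zero , suc zero

  from : C₂×C₂ → Height (Fin 2)
  from (zero , zero)         = ⊥ₕ
  from (suc zero , zero)     = atom zero
  from (zero , suc zero)     = atom (suc zero)
  from (suc zero , suc zero) = ⊤ₕ

  from∘to : ∀ h → from (to h) ≡ h
  from∘to ⊥ₕ                = refl
  from∘to (atom zero)       = refl
  from∘to (atom (suc zero)) = refl
  from∘to ⊤ₕ                = refl

  to∘from : ∀ c → to (from c) ≡ c
  to∘from (zero , zero)         = refl
  to∘from (suc zero , zero)     = refl
  to∘from (zero , suc zero)     = refl
  to∘from (suc zero , suc zero) = refl

  to-mono : ∀ {h h'} → h ≼ h' → to h ⊑₂₂ to h'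
  to-mono ⊥≼        = z≤n , z≤n
  to-mono (≼⊤ {h})  = ≤fromℕ (proj₁ (to h)) , ≤fromℕ (proj₂ (to h))
  to-mono atom≼atom = ≤ᶠ-refl , ≤ᶠ-refl

  to-reflect : ∀ h h' → to h ⊑₂₂ to h' → h ≼ h'
  to-reflect ⊥ₕ                _                 _        = ⊥≼
  to-reflect _                 ⊤ₕ                _        = ≼⊤
  to-reflect (atom zero)       (atom zero)       _        = atom≼atom
  to-reflect (atom (suc zero)) (atom (suc zero)) _        = atom≼atom
  to-reflect (atom zero)       ⊥ₕ                (() , _)
  to-reflect (atom zero)       (atom (suc zero)) (() , _)
  to-reflect (atom (suc zero)) ⊥ₕ                (_ , ())
  to-reflect (atom (suc zero)) (atom zero)       (_ , ())
  to-reflect ⊤ₕ                ⊥ₕ                (() , _)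
  to-reflect ⊤ₕ                (atom zero)       (_ , ())
  to-reflect ⊤ₕ                (atom (suc zero)) (() , _)

Height₃≅Π₃ : OrderIso (_≼_ {Fin 3}) _⊑Π_
Height₃≅Π₃ = record
  { to = to ; from = from ; from∘to = from∘to ; to∘from = to∘from
  ; to-mono = to-mono ; to-reflect = to-reflect _ _ }
  where
  to : Height (Fin 3) → Π₃
  to ⊥ₕ       = bot
  to (atom i) = mid i
  to ⊤ₕ       = top

  from : Π₃ → Height (Fin 3)
  from bot     = ⊥ₕ
  from (mid i) = atom i
  from top     = ⊤ₕ

  from∘to : ∀ h → from (to h) ≡ h
  from∘to ⊥ₕ       = refl
  from∘to (atom _) = refl
  from∘to ⊤ₕ       = refl

  to∘from : ∀ p → to (from p) ≡ p
  to∘from bot     = refl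
  to∘from (mid _) = refl
  to∘from top     = refl

  to-mono : ∀ {h h'} → h ≼ h' → to h ⊑Π to h'
  to-mono ⊥≼        = bot⊑
  to-mono ≼⊤        = ⊑top
  to-mono atom≼atom = mid⊑

  to-reflect : ∀ h h' → to h ⊑Π to h' → h ≼ h'
  to-reflect ⊥ₕ       _        _    = ⊥≼
  to-reflect _        ⊤ₕ       _    = ≼⊤
  to-reflect (atom i) (atom i) mid⊑ = atom≼atom
  to-reflect (atom _) ⊥ₕ       ()
  to-reflect ⊤ₕ       ⊥ₕ       ()
  to-reflect ⊤ₕ       (atom _) ()


module ShuffleProperties (M N : ℕ) where
  open Shuffle M N

  a≢x : ∀ {m k} → a m ≢ x k
  a≢x ()

  x≢a : ∀ {k m} → x k ≢ a m
  x≢a ()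

  x-injective : ∀ {k k'} → x k ≡ x k' → k ≡ k'
  x-injective refl = refl

  a-injective : ∀ {m m'} → a m ≡ a m' → m ≡ m'
  a-injective refl = refl

  _≟ₗ_ : DecidableEquality Letter
  a i ≟ₗ a j = map′ (cong a) a-injective (i ≟ j)
  a i ≟ₗ x j = no λ ()
  x i ≟ₗ a j = no λ ()
  x i ≟ₗ x j = map′ (cong x) x-injective (i ≟ j)

  _≟ʷ_ : DecidableEquality Word
  _≟ʷ_ = ≡-dec _≟ₗ_

  -- Shuffle words and rank

  IsShuffle-remove : ∀ {w w'} p {c q} → w ≡ p ++ c ∷ q → w' ≡ p ++ q → IsShuffle w → IsShuffle w'
  IsShuffle-remove p refl refl sh = record
    { distinct = Unique-splice⁻ p (IsShuffle.distinct sh)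
    ; a-incr   = Linked-mapMaybe-splice⁻ aIdx <ᶠ-trans p (IsShuffle.a-incr sh)
    ; x-incr   = Linked-mapMaybe-splice⁻ xIdx <ᶠ-trans p (IsShuffle.x-incr sh)
    }

  IsShuffle-between : ∀ {u t v} p {q} p' {q' k m} → u ≡ p ++ q → t ≡ p ++ x k ∷ q → t ≡ p' ++ a m ∷ q' → v ≡ p' ++ q' →
                      IsShuffle u → IsShuffle v → x k ∉ u → IsShuffle t
  IsShuffle-between p p' refl refl t≡ refl su sv x∉u = record
    { distinct = Unique-splice⁺ p (IsShuffle.distinct su) x∉u
    ; a-incr   = subst (Linked _<ᶠ_) (sym (mapMaybe-splice-nothing aIdx p refl)) (IsShuffle.a-incr su)
    ; x-incr   = subst (Linked _<ᶠ_) (trans (sym (mapMaybe-splice-nothing xIdx p' refl)) (cong (mapMaybe xIdx) (sym t≡)))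
                   (IsShuffle.x-incr sv)
    }

  countA-delete : ∀ p {q m} → countA (p ++ a m ∷ q) ≡ suc (countA (p ++ q))
  countA-delete p = length-mapMaybe-splice-just aIdx p refl

  countX-delete : ∀ p {q m} → countX (p ++ a m ∷ q) ≡ countX (p ++ q)
  countX-delete p = cong length (mapMaybe-splice-nothing xIdx p refl)

  countA-insert : ∀ p {q k} → countA (p ++ x k ∷ q) ≡ countA (p ++ q)
  countA-insert p = cong length (mapMaybe-splice-nothing aIdx p refl)

  countX-insert : ∀ p {q k} → countX (p ++ x k ∷ q) ≡ suc (countX (p ++ q))
  countX-insert p = length-mapMaybe-splice-just xIdx p refl

  countA≤M : ∀ {w} → IsShuffle w → countA w ≤ℕ M
  countA≤M sh = Linked-<-length≤ _ (IsShuffle.a-incr sh)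

  data Step (w w' : Word) : Set where
    deletion  : ∀ p q m → w ≡ p ++ a m ∷ q → w' ≡ p ++ q → Step w w'
    insertion : ∀ p q k → w ≡ p ++ q → w' ≡ p ++ x k ∷ q → Step w w'

  step : ∀ {w w'} → w ⋖ w' → Step w w'
  step (_ , _ , inj₁ (p , q , m , w≡ , w'≡)) = deletion p q m w≡ w'≡
  step (_ , _ , inj₂ (p , q , k , w≡ , w'≡)) = insertion p q k w≡ w'≡

  -- ρ uses truncated subtraction; it is exact here because countA w ≤ M for a shuffle w.
  ρ-⋖ : ∀ {w w'} → w ⋖ w' → ρ w' ≡ suc (ρ w)
  ρ-⋖ (sh , _ , inj₁ (p , q , m , refl , refl)) = begin
    M ∸ countA (p ++ q) + countX (p ++ q)
      ≡⟨ cong₂ _+_ (+-∸-assoc 1 (subst (_≤ℕ M) (countA-delete p) (countA≤M sh))) (sym (countX-delete p)) ⟩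
    suc (M ∸ suc (countA (p ++ q))) + countX (p ++ a m ∷ q)
      ≡⟨ cong (λ n → suc (M ∸ n + countX (p ++ a m ∷ q))) (countA-delete p) ⟨
    suc (ρ (p ++ a m ∷ q)) ∎
    where open ≡-Reasoning
  ρ-⋖ (_ , _ , inj₂ (p , q , k , refl , refl)) = begin
    M ∸ countA (p ++ x k ∷ q) + countX (p ++ x k ∷ q)
      ≡⟨ cong₂ (λ i j → M ∸ i + j) (countA-insert p) (countX-insert p) ⟩
    M ∸ countA (p ++ q) + suc (countX (p ++ q))
      ≡⟨ +-suc _ _ ⟩
    suc (ρ (p ++ q)) ∎
    where open ≡-Reasoning

  chainLength : ∀ {w w'} → w ≤ w' → ℕ
  chainLength ε       = 0
  chainLength (_ ◅ s) = suc (chainLength s)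

  ρ-≤ : ∀ {w w'} (s : w ≤ w') → ρ w' ≡ chainLength s + ρ w
  ρ-≤ ε       = refl
  ρ-≤ (r ◅ s) = trans (ρ-≤ s) (trans (cong (chainLength s +_) (ρ-⋖ r)) (+-suc _ _))

  ρ-mono : ∀ {w w'} → w ≤ w' → ρ w ≤ℕ ρ w'
  ρ-mono {w} s = subst (ρ w ≤ℕ_) (sym (ρ-≤ s)) (m≤n+m (ρ w) (chainLength s))

  ≤-same-rank⇒≡ : ∀ {w w'} → w ≤ w' → ρ w' ≡ ρ w → w ≡ w'
  ≤-same-rank⇒≡     ε       _  = refl
  ≤-same-rank⇒≡ {w} (r ◅ s) eq = contradiction (trans (sym eq) (ρ-≤ (r ◅ s))) (m≢1+n+m (ρ w) {chainLength s})

  ⋖-≤-asym : ∀ {w w'} → w ⋖ w' → ¬ w' ≤ w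
  ⋖-≤-asym {w} r s = 1+n≰n (subst (_≤ℕ ρ w) (ρ-⋖ r) (ρ-mono s))

  chainLengths≡2 : ∀ {u v w} → ρ v ≡ ρ u + 2 → (s : u ≤ w) (s' : w ≤ v) → chainLength s + chainLength s' ≡ 2
  chainLengths≡2 {u} {v} {w} ρv s s' = +-cancelʳ-≡ (ρ u) _ _ (begin
    chainLength s + chainLength s' + ρ u    ≡⟨ cong (_+ ρ u) (+-comm (chainLength s) _) ⟩
    chainLength s' + chainLength s + ρ u    ≡⟨ +-assoc (chainLength s') _ _ ⟩
    chainLength s' + (chainLength s + ρ u)  ≡⟨ cong (chainLength s' +_) (ρ-≤ s) ⟨
    chainLength s' + ρ w                    ≡⟨ ρ-≤ s' ⟨
    ρ v                                     ≡⟨ ρv ⟩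
    ρ u + 2                                 ≡⟨ +-comm (ρ u) 2 ⟩
    2 + ρ u                                 ∎)
    where open ≡-Reasoning

  x∈-⋖ : ∀ {k w w'} → w ⋖ w' → x k ∈ w → x k ∈ w'
  x∈-⋖ (_ , _ , inj₁ (p , q , m , refl , refl)) x∈ = ∈-splice⁻ p x∈ x≢a
  x∈-⋖ (_ , _ , inj₂ (p , q , k , refl , refl)) x∈ = ∈-splice⁺ p x∈

  a∈-⋖⁻ : ∀ {m w w'} → w ⋖ w' → a m ∈ w' → a m ∈ w
  a∈-⋖⁻ (_ , _ , inj₁ (p , _ , _ , refl , refl)) a∈ = ∈-splice⁺ p a∈
  a∈-⋖⁻ (_ , _ , inj₂ (p , _ , _ , refl , refl)) a∈ = ∈-splice⁻ p a∈ a≢x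

  x∈-≤ : ∀ {k w w'} → w ≤ w' → x k ∈ w → x k ∈ w'
  x∈-≤ ε       x∈ = x∈
  x∈-≤ (r ◅ s) x∈ = x∈-≤ s (x∈-⋖ r x∈)

  vertices-x∉ : ∀ {k w u} (s : w ≤ u) → x k ∉ u → All (x k ∉_) (vertices s ∷ʳ u)
  vertices-x∉ ε       x∉u = x∉u ∷ []
  vertices-x∉ (r ◅ s) x∉u = (x∉u ∘ x∈-≤ (r ◅ s)) ∷ vertices-x∉ s x∉u

  -- Intervals of length two

  data Layer (u v : Word) : Word → Set where
    bottom : Layer u v u
    middle : ∀ {t} → Mid u v t → Layer u v t
    top    : Layer u v v

  layer : ∀ {u v w} → ρ v ≡ ρ u + 2 → u ≤ w → w ≤ v → Layer u v w
  layer ρv ε                  _               = bottom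
  layer ρv (_ ◅ _)            ε               = top
  layer ρv (r ◅ ε)            (r' ◅ ε)        = middle (r , r')
  layer ρv s@(_ ◅ ε)          s'@(_ ◅ _ ◅ _)  = contradiction (chainLengths≡2 ρv s s') λ ()
  layer ρv s@(_ ◅ _ ◅ s₀)     s'@(_ ◅ s₀')    = contradiction (chainLengths≡2 ρv s s')
    (m+1+n≢0 (chainLength s₀) ∘ suc-injective ∘ suc-injective)

  layer-top : ∀ {u v} (ρv : ρ v ≡ ρ u + 2) (s : u ≤ v) → layer ρv s ε ≡ top
  layer-top {u} ρv ε       = contradiction (sym ρv) (m+1+n≢m (ρ u))
  layer-top     ρv (_ ◅ _) = refl

  IntervalIso-transport : ∀ {u v Q P} {_≤Q_ : Q → Q → Set} {_⊑_ : P → P → Set} →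
                          IntervalIso u v Q _≤Q_ → OrderIso _≤Q_ _⊑_ → IntervalIso u v P _⊑_
  IntervalIso-transport φ ψ = record
    { to      = ψ.to ∘ φ.to
    ; from    = φ.from ∘ ψ.from
    ; from-to = λ p → trans (cong (proj₁ ∘ φ.from) (ψ.from∘to (φ.to p))) (φ.from-to p)
    ; to-from = λ q → trans (cong ψ.to (φ.to-from (ψ.from q))) (ψ.to∘from q)
    ; to-mono = λ p q p≤q → ψ.to-mono (φ.to-mono p q p≤q)
    ; to-refl = λ p q ψφp≤ψφq → φ.to-refl p q (ψ.to-reflect ψφp≤ψφq)
    }
    where
    module φ = IntervalIso φ
    module ψ = OrderIso ψ

  module _ {u v : Word} (ρv : ρ v ≡ ρ u + 2) (u≤v : u ≤ v)
           {I : Set} (t : I → Word) (t-mid : ∀ i → Mid u v (t i))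
           (t-injective : ∀ {i j} → t i ≡ t j → i ≡ j)
           (t-surjective : ∀ {w} → Mid u v w → ∃ λ i → w ≡ t i) where

    private
      height : ∀ {w} → Layer u v w → Height I
      height bottom     = ⊥ₕ
      height (middle m) = atom (proj₁ (t-surjective m))
      height top        = ⊤ₕ

      fromHeight : Height I → Interval u v
      fromHeight ⊥ₕ       = u , ε , u≤v
      fromHeight (atom i) = t i , proj₁ (t-mid i) ◅ ε , proj₂ (t-mid i) ◅ ε
      fromHeight ⊤ₕ       = v , u≤v , ε

      fromHeight-height : ∀ {w} (ℓ : Layer u v w) → proj₁ (fromHeight (height ℓ)) ≡ w
      fromHeight-height bottom     = refl
      fromHeight-height (middle m) = sym (proj₂ (t-surjective m))
      fromHeight-height top        = refl

      height-fromHeight : ∀ h → let (_ , s , s') = fromHeight h in height (layer ρv s s') ≡ h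
      height-fromHeight ⊥ₕ       = refl
      height-fromHeight (atom i) = cong atom (t-injective (sym (proj₂ (t-surjective (t-mid i)))))
      height-fromHeight ⊤ₕ       = cong height (layer-top ρv u≤v)

      height-mono : ∀ {w w'} (ℓ : Layer u v w) (ℓ' : Layer u v w') → w ≤ w' → height ℓ ≼ height ℓ'
      height-mono bottom       _             _   = ⊥≼
      height-mono _            top           _   = ≼⊤
      height-mono (middle m)   bottom        t≤u = contradiction t≤u (⋖-≤-asym (proj₁ m))
      height-mono top          (middle m)    v≤t = contradiction v≤t (⋖-≤-asym (proj₂ m))
      height-mono top          bottom        v≤u = contradiction (ρ-mono v≤u) λ ρv≤ρu →
        m+1+n≰m (ρ u) (subst (_≤ℕ ρ u) ρv ρv≤ρu)
      height-mono (middle m)   (middle m')   t≤t'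
        with refl ← ≤-same-rank⇒≡ t≤t' (trans (ρ-⋖ (proj₁ m')) (sym (ρ-⋖ (proj₁ m))))
        with i , t≡ ← t-surjective m | j , t≡′ ← t-surjective m'
        with refl ← t-injective (trans (sym t≡) t≡′) = atom≼atom

      height-reflect : ∀ {w w'} (ℓ : Layer u v w) (ℓ' : Layer u v w') → u ≤ w' → w ≤ v →
                       height ℓ ≼ height ℓ' → w ≤ w'
      height-reflect bottom     _           u≤w' _    _  = u≤w'
      height-reflect _          top         _    w≤v  _  = w≤v
      height-reflect (middle m) (middle m') _    _    h≼h'
        with i , t≡ ← t-surjective m | j , t≡′ ← t-surjective m' | atom≼atom ← h≼h' =
        subst (_ ≤_) (trans t≡ (sym t≡′)) ε
      height-reflect (middle _) bottom     _ _ ()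
      height-reflect top        bottom     _ _ ()
      height-reflect top        (middle _) _ _ ()

    intervalIso-Height : IntervalIso u v (Height I) _≼_
    intervalIso-Height = record
      { to      = λ (_ , s , s') → height (layer ρv s s')
      ; from    = fromHeight
      ; from-to = λ (_ , s , s') → fromHeight-height (layer ρv s s')
      ; to-from = height-fromHeight
      ; to-mono = λ (_ , s , s') (_ , z , z') → height-mono (layer ρv s s') (layer ρv z z')
      ; to-refl = λ (_ , s , s') (_ , z , z') → height-reflect (layer ρv s s') (layer ρv z z') z s'
      }

  intervalIso-C₂×C₂ : ∀ {u v t₁ t₂} → ρ v ≡ ρ u + 2 → u ≤ v → t₁ ≢ t₂ → Mid u v t₁ → Mid u v t₂ →
                      (∀ t → Mid u v t → t ≡ t₁ ⊎ t ≡ t₂) → IntervalIso u v C₂×C₂ _⊑₂₂_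
  intervalIso-C₂×C₂ {u} {v} {t₁} {t₂} ρv u≤v t₁≢t₂ mid₁ mid₂ cover =
    IntervalIso-transport (intervalIso-Height ρv u≤v t t-mid t-injective t-surjective) Height₂≅C₂×C₂
    where
    t : Fin 2 → Word
    t zero       = t₁
    t (suc zero) = t₂

    t-mid : ∀ i → Mid u v (t i)
    t-mid zero       = mid₁
    t-mid (suc zero) = mid₂

    t-injective : ∀ {i j} → t i ≡ t j → i ≡ j
    t-injective {zero}     {zero}     _  = refl
    t-injective {zero}     {suc zero} eq = contradiction eq t₁≢t₂
    t-injective {suc zero} {zero}     eq = contradiction (sym eq) t₁≢t₂
    t-injective {suc zero} {suc zero} _  = refl

    t-surjective : ∀ {w} → Mid u v w → ∃ λ i → w ≡ t i
    t-surjective {w} m with cover w m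
    ... | inj₁ w≡ = zero , w≡
    ... | inj₂ w≡ = suc zero , w≡

  intervalIso-Π₃ : ∀ {u v t₁ t₂ t₃} → ρ v ≡ ρ u + 2 → u ≤ v → t₁ ≢ t₂ → t₁ ≢ t₃ → t₂ ≢ t₃ →
                   Mid u v t₁ → Mid u v t₂ → Mid u v t₃ →
                   (∀ t → Mid u v t → t ≡ t₁ ⊎ t ≡ t₂ ⊎ t ≡ t₃) → IntervalIso u v Π₃ _⊑Π_
  intervalIso-Π₃ {u} {v} {t₁} {t₂} {t₃} ρv u≤v t₁≢t₂ t₁≢t₃ t₂≢t₃ mid₁ mid₂ mid₃ cover =
    IntervalIso-transport (intervalIso-Height ρv u≤v t t-mid t-injective t-surjective) Height₃≅Π₃
    where
    t : Fin 3 → Word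
    t zero             = t₁
    t (suc zero)       = t₂
    t (suc (suc zero)) = t₃

    t-mid : ∀ i → Mid u v (t i)
    t-mid zero             = mid₁
    t-mid (suc zero)       = mid₂
    t-mid (suc (suc zero)) = mid₃

    t-injective : ∀ {i j} → t i ≡ t j → i ≡ j
    t-injective {zero}             {zero}             _  = refl
    t-injective {zero}             {suc zero}         eq = contradiction eq t₁≢t₂
    t-injective {zero}             {suc (suc zero)}   eq = contradiction eq t₁≢t₃
    t-injective {suc zero}         {zero}             eq = contradiction (sym eq) t₁≢t₂
    t-injective {suc zero}         {suc zero}         _  = refl
    t-injective {suc zero}         {suc (suc zero)}   eq = contradiction eq t₂≢t₃
    t-injective {suc (suc zero)}   {zero}             eq = contradiction (sym eq) t₁≢t₃
    t-injective {suc (suc zero)}   {suc zero}         eq = contradiction (sym eq) t₂≢t₃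
    t-injective {suc (suc zero)}   {suc (suc zero)}   _  = refl

    t-surjective : ∀ {w} → Mid u v w → ∃ λ i → w ≡ t i
    t-surjective {w} m with cover w m
    ... | inj₁ w≡        = zero , w≡
    ... | inj₂ (inj₁ w≡) = suc zero , w≡
    ... | inj₂ (inj₂ w≡) = suc (suc zero) , w≡

  -- The labelling Λ

  DelAfterHead : Fin N → Word → Word → Set
  DelAfterHead k p q = Σ Word λ r → Σ (Fin M) λ m → (p ≡ x k ∷ a m ∷ r) × (q ≡ x k ∷ r)

  delAfterHead? : ∀ k p q → Dec (DelAfterHead k p q)
  delAfterHead? k (x k' ∷ a m ∷ r) q with k' ≟ k | q ≟ʷ (x k ∷ r)
  ... | yes refl | yes refl = yes (r , m , refl , refl)
  ... | no k'≢k  | _        = no λ { (_ , _ , refl , _) → k'≢k refl }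
  ... | yes _    | no q≢    = no λ { (_ , _ , refl , q≡) → q≢ q≡ }
  delAfterHead? k []                q = no λ { (_ , _ , () , _) }
  delAfterHead? k (a _ ∷ _)         q = no λ { (_ , _ , () , _) }
  delAfterHead? k (x _ ∷ [])        q = no λ { (_ , _ , () , _) }
  delAfterHead? k (x _ ∷ x _ ∷ _)   q = no λ { (_ , _ , () , _) }

  delAfter? : ∀ k p q → Dec (DelAfter k p q)
  delAfter? k []      q  = no λ { ([] , _ , _ , () , _) ; (_ ∷ _ , _ , _ , () , _) }
  delAfter? k (c ∷ p) [] = no λ { ([] , _ , _ , _ , ()) ; (_ ∷ _ , _ , _ , _ , ()) }
  delAfter? k (c ∷ p) (c' ∷ q) with delAfterHead? k (c ∷ p) (c' ∷ q) | c ≟ₗ c' | delAfter? k p q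
  ... | yes (r , m , p≡ , q≡) | _        | _ = yes ([] , r , m , p≡ , q≡)
  ... | no _    | yes refl | yes (u , r , m , p≡ , q≡) = yes (c ∷ u , r , m , cong (c ∷_) p≡ , cong (c ∷_) q≡)
  ... | no ¬head | yes refl | no ¬tail = no λ
    { ([] , r , m , p≡ , q≡)    → ¬head (r , m , p≡ , q≡)
    ; (_ ∷ u , r , m , p≡ , q≡) → ¬tail (u , r , m , ∷-injectiveʳ p≡ , ∷-injectiveʳ q≡) }
  ... | no ¬head | no c≢c'  | _ = no λ
    { ([] , r , m , p≡ , q≡)    → ¬head (r , m , p≡ , q≡)
    ; (_ ∷ _ , _ , _ , p≡ , q≡) → c≢c' (trans (∷-injectiveˡ p≡) (sym (∷-injectiveˡ q≡))) }

  noDelAfter? : ∀ k ws → Dec (NoDelAfter k ws)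
  noDelAfter? k ws = all? (λ (w , w') → ¬? (delAfter? k w w')) (steps ws)

  -- The label of deleting c right after the letter y (if any), when ws = w⁰ … wⁱ ends with
  -- the word being changed.
  labelAfter : List Word → Maybe Letter → Letter → Letter
  labelAfter ws (just (x k)) c with noDelAfter? k ws
  ... | yes _ = x k
  ... | no  _ = c
  labelAfter ws _ c = c

  deletionLabel : List Word → Word → Fin M → Letter
  deletionLabel ws p m = labelAfter ws (last p) (a m)

  labelAfter-cases : ∀ ws y c → labelAfter ws y c ≡ c ⊎ ∃ λ k → y ≡ just (x k) × labelAfter ws y c ≡ x k
  labelAfter-cases ws (just (x k)) c with noDelAfter? k ws
  ... | yes _ = inj₂ (k , refl , refl)
  ... | no  _ = inj₁ refl
  labelAfter-cases ws (just (a _)) c = inj₁ refl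
  labelAfter-cases ws nothing      c = inj₁ refl

  labelAfter-¬noDelAfter : ∀ ws y c → (∀ {k} → y ≡ just (x k) → ¬ NoDelAfter k ws) → labelAfter ws y c ≡ c
  labelAfter-¬noDelAfter ws (just (x k)) c ¬none with noDelAfter? k ws
  ... | yes none = contradiction none (¬none refl)
  ... | no  _    = refl
  labelAfter-¬noDelAfter ws (just (a _)) c _ = refl
  labelAfter-¬noDelAfter ws nothing      c _ = refl

  steps-∷ʳ : ∀ (H : List Word) u t → steps ((H ∷ʳ u) ∷ʳ t) ≡ steps (H ∷ʳ u) ∷ʳ (u , t)
  steps-∷ʳ []           u t = refl
  steps-∷ʳ (_ ∷ [])     u t = refl
  steps-∷ʳ (h ∷ h' ∷ H) u t = cong ((h , h') ∷_) (steps-∷ʳ (h' ∷ H) u t)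

  noDelAfter-∷ʳ⁻ : ∀ {k} H {u t} → NoDelAfter k ((H ∷ʳ u) ∷ʳ t) → NoDelAfter k (H ∷ʳ u) × ¬ DelAfter k u t
  noDelAfter-∷ʳ⁻ H {u} {t} none rewrite steps-∷ʳ H u t with none-H , (¬da ∷ []) ← ++⁻ (steps (H ∷ʳ u)) none =
    none-H , ¬da

  noDelAfter-∷ʳ⁺ : ∀ {k} H {u t} → NoDelAfter k (H ∷ʳ u) → ¬ DelAfter k u t → NoDelAfter k ((H ∷ʳ u) ∷ʳ t)
  noDelAfter-∷ʳ⁺ H {u} {t} none ¬da rewrite steps-∷ʳ H u t = ++⁺ none (¬da ∷ [])

  labelAfter-∷ʳ : ∀ H {u t} y c → (∀ {k} → y ≡ just (x k) → ¬ DelAfter k u t) →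
                  labelAfter ((H ∷ʳ u) ∷ʳ t) y c ≡ labelAfter (H ∷ʳ u) y c
  labelAfter-∷ʳ H {u} {t} (just (x k)) c ¬da
    with noDelAfter? k ((H ∷ʳ u) ∷ʳ t) | noDelAfter? k (H ∷ʳ u)
  ... | yes _    | yes _    = refl
  ... | no  _    | no  _    = refl
  ... | yes none | no ¬none = contradiction (proj₁ (noDelAfter-∷ʳ⁻ H none)) ¬none
  ... | no ¬none | yes none = contradiction (noDelAfter-∷ʳ⁺ H none (¬da refl)) ¬none
  labelAfter-∷ʳ H (just (a _)) c _ = refl
  labelAfter-∷ʳ H nothing      c _ = refl

  insertion-¬delAfter : ∀ {k w w'} p {q c} → w ≡ p ++ q → w' ≡ p ++ c ∷ q → ¬ DelAfter k w w'
  insertion-¬delAfter {k} p {q} {c} refl refl (u , v , m , p++q≡ , p++c∷q≡) = 1+n≰n (begin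
    suc (suc (length (u ++ v)))  ≡⟨ cong suc (length-splice u) ⟨
    suc (length (u ++ a m ∷ v))  ≡⟨ length-splice u ⟨
    length (u ++ x k ∷ a m ∷ v)  ≡⟨ cong length p++q≡ ⟨
    length (p ++ q)              <⟨ ≤-reflexive (sym (length-splice p)) ⟩
    length (p ++ c ∷ q)          ≡⟨ cong length p++c∷q≡ ⟩
    length (u ++ x k ∷ v)        ≡⟨ length-splice u ⟩
    suc (length (u ++ v))        ∎)
    where open ≤-Reasoning

  x∉⇒¬delAfter : ∀ {k p q} → x k ∉ p → ¬ DelAfter k p q
  x∉⇒¬delAfter x∉p (u , _ , _ , p≡ , _) = x∉p (subst (_ ∈_) (sym p≡) (∈-insert u))

  noDelAfter-absent : ∀ {k} ws {w} → All (x k ∉_) ws → NoDelAfter k (ws ∷ʳ w)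
  noDelAfter-absent []            _            = []
  noDelAfter-absent (p ∷ [])      (x∉p ∷ _)    = x∉⇒¬delAfter x∉p ∷ []
  noDelAfter-absent (p ∷ p' ∷ ws) (x∉p ∷ x∉ws) = x∉⇒¬delAfter x∉p ∷ noDelAfter-absent (p' ∷ ws) x∉ws

  delAfter⇒last : ∀ {k} p {q m} → Unique (p ++ a m ∷ q) → DelAfter k (p ++ a m ∷ q) (p ++ q) → last p ≡ just (x k)
  delAfter⇒last {k} p {q} uniq (p' , q' , m' , p++a∷q≡ , p++q≡)
    with refl , _ ← deleted-unique p (p' ∷ʳ x k) uniq
                      (trans p++a∷q≡ (sym (++-assoc p' [ x k ] (a m' ∷ q'))))
                      (trans p++q≡ (sym (++-assoc p' [ x k ] q'))) = last-++-∷ p'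

  last⇒delAfter : ∀ {k} p {q m} → last p ≡ just (x k) → DelAfter k (p ++ a m ∷ q) (p ++ q)
  last⇒delAfter p {q} {m} last≡ with p' , refl ← last≡just⇒∷ʳ p last≡ =
    p' , q , m , ++-assoc p' _ (a m ∷ q) , ++-assoc p' _ q

  deletion-hasLabel : ∀ H {w w'} p q m → w ≡ p ++ a m ∷ q → w' ≡ p ++ q → Unique w →
                      HasLabel H w w' (deletionLabel (H ∷ʳ w) p m)
  deletion-hasLabel H p q m refl refl uniq with last p in last≡
  ... | nothing    = lab-a m (p , q , refl , refl) λ (k , da , _) →
                       contradiction (trans (sym last≡) (delAfter⇒last p uniq da)) λ ()
  ... | just (a _) = lab-a m (p , q , refl , refl) λ (k , da , _) →
                       contradiction (trans (sym last≡) (delAfter⇒last p uniq da)) λ ()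
  ... | just (x k) with noDelAfter? k (H ∷ʳ (p ++ a m ∷ q))
  ...   | yes none = lab-xa k (last⇒delAfter p last≡) none
  ...   | no ¬none = lab-a m (p , q , refl , refl) λ (k' , da , none) →
                       ¬none (subst (λ k → NoDelAfter k _)
                                    (x-injective (just-injective (trans (sym (delAfter⇒last p uniq da)) last≡))) none)

  -- Two insertions or two deletions

  LabelledC₂×C₂ : List Word → Word → Word → Set
  LabelledC₂×C₂ H u v =
    Σ Word λ t₁ → Σ Word λ t₂ → t₁ ≢ t₂ × Mid u v t₁ × Mid u v t₂ ×
      (∀ t → Mid u v t → t ≡ t₁ ⊎ t ≡ t₂) ×
      Σ Letter λ l₁ → Σ Letter λ l₂ → l₁ ≢ l₂ ×
        LabelPair H u t₁ v l₁ l₂ × LabelPair H u t₂ v l₂ l₁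

  LabelledΠ₃ : List Word → Word → Word → Set
  LabelledΠ₃ H u v =
    Σ Word λ t₁ → Σ Word λ t₂ → Σ Word λ t₃ →
      t₁ ≢ t₂ × t₁ ≢ t₃ × t₂ ≢ t₃ × Mid u v t₁ × Mid u v t₂ × Mid u v t₃ ×
      (∀ t → Mid u v t → t ≡ t₁ ⊎ t ≡ t₂ ⊎ t ≡ t₃) ×
      Σ (Fin N) λ j → Σ Letter λ l → l ≢ x j ×
        LabelPair H u t₁ v (x j) l × LabelPair H u t₂ v l (x j) × LabelPair H u t₃ v (x j) (x j)

  two-insertions-middle : ∀ P Mw Q {k₁ k₂ t} → Unique (P ++ x k₁ ∷ Mw ++ x k₂ ∷ Q) →
                          Mid (P ++ Mw ++ Q) (P ++ x k₁ ∷ Mw ++ x k₂ ∷ Q) t →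
                          t ≡ P ++ x k₁ ∷ Mw ++ Q ⊎ t ≡ P ++ Mw ++ x k₂ ∷ Q
  two-insertions-middle P Mw Q {k₁} {k₂} uniq-v (r₁ , r₂) with step r₂
  ... | deletion p q m t≡ v≡ =
    contradiction (∈-splice₂⁺ P Mw (a∈-⋖⁻ r₁ (spliced-∈ p t≡))) (removed-∉ p (IsShuffle.distinct (proj₁ r₂)) t≡ v≡)
  ... | insertion p q k t≡ v≡ with k ≟ k₁ | k ≟ k₂
  ...   | yes refl | _        = inj₂ (removed-unique p P uniq-v v≡ t≡ refl refl)
  ...   | no _     | yes refl = inj₁ (removed-unique p (P ++ x k₁ ∷ Mw) uniq-v v≡ t≡
                                       (sym (++-assoc P (x k₁ ∷ Mw) _)) (sym (++-assoc P (x k₁ ∷ Mw) Q)))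
  ...   | no k≢k₁  | no k≢k₂  = contradiction
    (x∈-⋖ r₁ (∈-splice₂⁻ P Mw (spliced-∈ p v≡) (k≢k₁ ∘ x-injective) (k≢k₂ ∘ x-injective)))
    (removed-∉ p uniq-v v≡ t≡)

  two-insertions : ∀ H P Mw Q k₁ k₂ → IsShuffle (P ++ Mw ++ Q) → IsShuffle (P ++ x k₁ ∷ Mw ++ x k₂ ∷ Q) →
                   LabelledC₂×C₂ H (P ++ Mw ++ Q) (P ++ x k₁ ∷ Mw ++ x k₂ ∷ Q)
  two-insertions H P Mw Q k₁ k₂ su sv =
    t₁ , t₂ , t₁≢t₂ ,
    ((su , s₁ , inj₂ (P , Mw ++ Q , k₁ , refl , refl)) , (s₁ , sv , inj₂ (P ++ x k₁ ∷ Mw , Q , k₂ , t₁≡ , v≡))) ,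
    ((su , s₂ , inj₂ (P ++ Mw , Q , k₂ , u≡ , t₂≡)) , (s₂ , sv , inj₂ (P , Mw ++ x k₂ ∷ Q , k₁ , refl , refl))) ,
    (λ _ → two-insertions-middle P Mw Q uniq-v) ,
    x k₁ , x k₂ , (λ k₁≡k₂ → x∉t₂ (subst (_∈ t₂) (sym k₁≡k₂) x₂∈t₂)) ,
    (lab-x k₁ (P , Mw ++ Q , refl , refl) , lab-x k₂ (P ++ x k₁ ∷ Mw , Q , t₁≡ , v≡)) ,
    (lab-x k₂ (P ++ Mw , Q , u≡ , t₂≡) , lab-x k₁ (P , Mw ++ x k₂ ∷ Q , refl , refl))
    where
    t₁ t₂ : Word
    t₁ = P ++ x k₁ ∷ Mw ++ Q
    t₂ = P ++ Mw ++ x k₂ ∷ Q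
    uniq-v : Unique (P ++ x k₁ ∷ Mw ++ x k₂ ∷ Q)
    uniq-v = IsShuffle.distinct sv
    u≡ : P ++ Mw ++ Q ≡ (P ++ Mw) ++ Q
    u≡ = reassoc P Mw refl
    t₁≡ : t₁ ≡ (P ++ x k₁ ∷ Mw) ++ Q
    t₁≡ = reassoc P (x k₁ ∷ Mw) refl
    t₂≡ : t₂ ≡ (P ++ Mw) ++ x k₂ ∷ Q
    t₂≡ = reassoc P Mw refl
    v≡ : P ++ x k₁ ∷ Mw ++ x k₂ ∷ Q ≡ (P ++ x k₁ ∷ Mw) ++ x k₂ ∷ Q
    v≡ = reassoc P (x k₁ ∷ Mw) refl
    s₁ : IsShuffle t₁
    s₁ = IsShuffle-remove (P ++ x k₁ ∷ Mw) v≡ t₁≡ sv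
    s₂ : IsShuffle t₂
    s₂ = IsShuffle-remove P refl refl sv
    x∉t₂ : x k₁ ∉ t₂
    x∉t₂ = removed-∉ P uniq-v refl refl
    x₂∈t₂ : x k₂ ∈ t₂
    x₂∈t₂ = spliced-∈ (P ++ Mw) t₂≡
    t₁≢t₂ : t₁ ≢ t₂
    t₁≢t₂ t₁≡t₂ = x∉t₂ (subst (x k₁ ∈_) t₁≡t₂ (∈-insert P))

  two-deletions-middle : ∀ P Mw Q {m₁ m₂ t} → Unique (P ++ a m₁ ∷ Mw ++ a m₂ ∷ Q) →
                         Mid (P ++ a m₁ ∷ Mw ++ a m₂ ∷ Q) (P ++ Mw ++ Q) t →
                         t ≡ P ++ Mw ++ a m₂ ∷ Q ⊎ t ≡ P ++ a m₁ ∷ Mw ++ Q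
  two-deletions-middle P Mw Q {m₁} {m₂} uniq-u (r₁ , r₂) with step r₁
  ... | insertion p q k u≡ t≡ =
    contradiction (∈-splice₂⁺ P Mw (x∈-⋖ r₂ (spliced-∈ p t≡))) (removed-∉ p (IsShuffle.distinct (proj₁ (proj₂ r₁))) t≡ u≡)
  ... | deletion p q m u≡ t≡ with m ≟ m₁ | m ≟ m₂
  ...   | yes refl | _        = inj₁ (removed-unique p P uniq-u u≡ t≡ refl refl)
  ...   | no _     | yes refl = inj₂ (removed-unique p (P ++ a m₁ ∷ Mw) uniq-u u≡ t≡
                                       (sym (++-assoc P (a m₁ ∷ Mw) _)) (sym (++-assoc P (a m₁ ∷ Mw) Q)))
  ...   | no m≢m₁  | no m≢m₂  = contradiction
    (a∈-⋖⁻ r₂ (∈-splice₂⁻ P Mw (spliced-∈ p u≡) (m≢m₁ ∘ a-injective) (m≢m₂ ∘ a-injective)))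
    (removed-∉ p uniq-u u≡ t≡)

  last-x-unique : ∀ P Mw {m k R} → Unique (P ++ a m ∷ Mw ++ R) → last P ≡ just (x k) → last (P ++ a m ∷ Mw) ≢ just (x k)
  last-x-unique P []       _    _      last≡ = contradiction (just-injective (trans (sym (last-++-∷ P)) last≡)) a≢x
  last-x-unique P (e ∷ Mw) uniq last-P last≡ = Unique-++⇒disjoint P uniq (last≡just⇒∈ P last-P)
    (there (∈-++⁺ˡ (last≡just⇒∈ (e ∷ Mw) (trans (sym (last-++-∷ P)) last≡))))

  two-deletions-labels-differ : ∀ H P Mw Q {m₁ m₂} → let u = P ++ a m₁ ∷ Mw ++ a m₂ ∷ Q in Unique u →
                                deletionLabel (H ∷ʳ u) P m₁ ≢ deletionLabel (H ∷ʳ u) (P ++ a m₁ ∷ Mw) m₂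
  two-deletions-labels-differ H P Mw Q {m₁} {m₂} uniq l₁≡l₂
    with labelAfter-cases (H ∷ʳ (P ++ a m₁ ∷ Mw ++ a m₂ ∷ Q)) (last P) (a m₁)
       | labelAfter-cases (H ∷ʳ (P ++ a m₁ ∷ Mw ++ a m₂ ∷ Q)) (last (P ++ a m₁ ∷ Mw)) (a m₂)
  ... | inj₁ l₁≡ | inj₁ l₂≡ = Unique-splice⇒∉ P uniq
    (subst (_∈ P ++ Mw ++ a m₂ ∷ Q) (trans (sym l₂≡) (trans (sym l₁≡l₂) l₁≡)) (∈-++⁺ʳ P (∈-insert Mw)))
  ... | inj₁ l₁≡ | inj₂ (_ , _ , l₂≡) = a≢x (trans (sym l₁≡) (trans l₁≡l₂ l₂≡))
  ... | inj₂ (_ , _ , l₁≡) | inj₁ l₂≡ = x≢a (trans (sym l₁≡) (trans l₁≡l₂ l₂≡))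
  ... | inj₂ (_ , last-P , l₁≡) | inj₂ (_ , last≡ , l₂≡)
    with refl ← trans (sym l₁≡) (trans l₁≡l₂ l₂≡) = last-x-unique P Mw uniq last-P last≡

  two-deletions-second-label₁ : ∀ H P Mw Q {m₁ m₂} → let u = P ++ a m₁ ∷ Mw ++ a m₂ ∷ Q in Unique u →
    deletionLabel ((H ∷ʳ u) ∷ʳ (P ++ Mw ++ a m₂ ∷ Q)) (P ++ Mw) m₂ ≡ deletionLabel (H ∷ʳ u) (P ++ a m₁ ∷ Mw) m₂
  -- The first deletion was right after last P, so the (xa) rule cannot fire for it again.
  two-deletions-second-label₁ H P [] Q {m₁} {m₂} uniq rewrite ++-identityʳ P = trans
    (labelAfter-¬noDelAfter _ (last P) (a m₂) λ last≡ none →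
      proj₂ (noDelAfter-∷ʳ⁻ H none) (last⇒delAfter P last≡))
    (cong (λ y → labelAfter (H ∷ʳ (P ++ a m₁ ∷ a m₂ ∷ Q)) y (a m₂)) (sym (last-++-∷ P)))
  two-deletions-second-label₁ H P (e ∷ Mw) Q {m₁} {m₂} uniq = begin
    labelAfter (G ∷ʳ t) (last (P ++ e ∷ Mw)) (a m₂)  ≡⟨ cong (λ y → labelAfter (G ∷ʳ t) y (a m₂)) (last-++-∷ P) ⟩
    labelAfter (G ∷ʳ t) (last (e ∷ Mw)) (a m₂)       ≡⟨ labelAfter-∷ʳ H (last (e ∷ Mw)) (a m₂) ¬delAfter ⟩
    labelAfter G (last (e ∷ Mw)) (a m₂)              ≡⟨ cong (λ y → labelAfter G y (a m₂)) (last-++-∷ P) ⟨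
    labelAfter G (last (P ++ a m₁ ∷ e ∷ Mw)) (a m₂)  ∎
    where
    open ≡-Reasoning
    u t : Word
    u = P ++ a m₁ ∷ e ∷ Mw ++ a m₂ ∷ Q
    t = P ++ e ∷ Mw ++ a m₂ ∷ Q
    G : List Word
    G = H ∷ʳ u
    ¬delAfter : ∀ {k} → last (e ∷ Mw) ≡ just (x k) → ¬ DelAfter k u t
    ¬delAfter last≡ da = Unique-++⇒disjoint P uniq (last≡just⇒∈ P (delAfter⇒last P uniq da))
      (there (∈-++⁺ˡ (last≡just⇒∈ (e ∷ Mw) last≡)))

  two-deletions-second-label₂ : ∀ H P Mw Q {m₁ m₂} → let u = P ++ a m₁ ∷ Mw ++ a m₂ ∷ Q in Unique u →
    deletionLabel ((H ∷ʳ u) ∷ʳ (P ++ a m₁ ∷ Mw ++ Q)) P m₁ ≡ deletionLabel (H ∷ʳ u) P m₁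
  two-deletions-second-label₂ H P Mw Q {m₁} {m₂} uniq = labelAfter-∷ʳ H (last P) (a m₁) λ last≡ da →
    last-x-unique P Mw uniq last≡
      (delAfter⇒last (P ++ a m₁ ∷ Mw) (subst Unique u≡ uniq) (subst₂ (DelAfter _) u≡ (sym (++-assoc P (a m₁ ∷ Mw) Q)) da))
    where
    u≡ : P ++ a m₁ ∷ Mw ++ a m₂ ∷ Q ≡ (P ++ a m₁ ∷ Mw) ++ a m₂ ∷ Q
    u≡ = reassoc P (a m₁ ∷ Mw) refl

  two-deletions : ∀ H P Mw Q m₁ m₂ → IsShuffle (P ++ a m₁ ∷ Mw ++ a m₂ ∷ Q) → IsShuffle (P ++ Mw ++ Q) →
                  LabelledC₂×C₂ H (P ++ a m₁ ∷ Mw ++ a m₂ ∷ Q) (P ++ Mw ++ Q)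
  two-deletions H P Mw Q m₁ m₂ su sv =
    t₁ , t₂ , t₁≢t₂ ,
    ((su , s₁ , inj₁ (P , Mw ++ a m₂ ∷ Q , m₁ , refl , refl)) , (s₁ , sv , inj₁ (P ++ Mw , Q , m₂ , t₁≡ , v≡))) ,
    ((su , s₂ , inj₁ (P ++ a m₁ ∷ Mw , Q , m₂ , u≡ , t₂≡)) , (s₂ , sv , inj₁ (P , Mw ++ Q , m₁ , refl , refl))) ,
    (λ _ → two-deletions-middle P Mw Q uniq-u) ,
    l₁ , l₂ , two-deletions-labels-differ H P Mw Q uniq-u ,
    (deletion-hasLabel H P _ m₁ refl refl uniq-u ,
     subst (HasLabel _ t₁ _) (two-deletions-second-label₁ H P Mw Q uniq-u)
       (deletion-hasLabel (H ∷ʳ u) (P ++ Mw) Q m₂ t₁≡ v≡ (IsShuffle.distinct s₁))) ,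
    (deletion-hasLabel H (P ++ a m₁ ∷ Mw) Q m₂ u≡ t₂≡ uniq-u ,
     subst (HasLabel _ t₂ _) (two-deletions-second-label₂ H P Mw Q uniq-u)
       (deletion-hasLabel (H ∷ʳ u) P (Mw ++ Q) m₁ refl refl (IsShuffle.distinct s₂)))
    where
    u t₁ t₂ : Word
    u  = P ++ a m₁ ∷ Mw ++ a m₂ ∷ Q
    t₁ = P ++ Mw ++ a m₂ ∷ Q
    t₂ = P ++ a m₁ ∷ Mw ++ Q
    l₁ l₂ : Letter
    l₁ = deletionLabel (H ∷ʳ u) P m₁
    l₂ = deletionLabel (H ∷ʳ u) (P ++ a m₁ ∷ Mw) m₂
    uniq-u : Unique u
    uniq-u = IsShuffle.distinct su
    u≡ : u ≡ (P ++ a m₁ ∷ Mw) ++ a m₂ ∷ Q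
    u≡ = reassoc P (a m₁ ∷ Mw) refl
    t₁≡ : t₁ ≡ (P ++ Mw) ++ a m₂ ∷ Q
    t₁≡ = reassoc P Mw refl
    t₂≡ : t₂ ≡ (P ++ a m₁ ∷ Mw) ++ Q
    t₂≡ = reassoc P (a m₁ ∷ Mw) refl
    v≡ : P ++ Mw ++ Q ≡ (P ++ Mw) ++ Q
    v≡ = reassoc P Mw refl
    s₁ : IsShuffle t₁
    s₁ = IsShuffle-remove P refl refl su
    s₂ : IsShuffle t₂
    s₂ = IsShuffle-remove (P ++ a m₁ ∷ Mw) u≡ t₂≡ su
    t₁≢t₂ : t₁ ≢ t₂
    t₁≢t₂ t₁≡t₂ = removed-∉ P uniq-u refl refl (subst (a m₁ ∈_) (sym t₁≡t₂) (∈-insert P))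

  -- A deletion and an insertion

  record XAfterA (m : Fin M) (k : Fin N) (u v t P Mw S : Word) : Set where
    constructor x-after-a
    field
      u≡ : u ≡ P ++ a m ∷ Mw ++ S
      v≡ : v ≡ P ++ Mw ++ x k ∷ S
      t≡ : t ≡ P ++ a m ∷ Mw ++ x k ∷ S

  record XBeforeA (m : Fin M) (k : Fin N) (u v t R Mw Q : Word) : Set where
    constructor x-before-a
    field
      u≡ : u ≡ R ++ Mw ++ a m ∷ Q
      v≡ : v ≡ R ++ x k ∷ Mw ++ Q
      t≡ : t ≡ R ++ x k ∷ Mw ++ a m ∷ Q

  module DeletionInsertion (H : List Word) {m : Fin M} {k : Fin N} {u v : Word} (su : IsShuffle u) (sv : IsShuffle v)
                      (Pu Su Pv Sv : Word) (u≡ : u ≡ Pu ++ a m ∷ Su) (v≡ : v ≡ Pv ++ x k ∷ Sv)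
                      (t₀≡ : Pu ++ Su ≡ Pv ++ Sv) where

    t₀ : Word
    t₀ = Pu ++ Su

    l : Letter
    l = deletionLabel (H ∷ʳ u) Pu m

    uniq-u : Unique u
    uniq-u = IsShuffle.distinct su
    uniq-v : Unique v
    uniq-v = IsShuffle.distinct sv

    u⊆v : ∀ {d} → d ∈ u → d ≢ a m → d ∈ v
    u⊆v d∈u d≢a = ∈-spliced⁺ Pv t₀≡ v≡ (∈-spliced⁻ Pu u≡ refl d∈u d≢a)

    v⊆u : ∀ {d} → d ∈ v → d ≢ x k → d ∈ u
    v⊆u d∈v d≢x = ∈-spliced⁺ Pu refl u≡ (∈-spliced⁻ Pv v≡ t₀≡ d∈v d≢x)

    x∉u : x k ∉ u
    x∉u x∈u = removed-∉ Pv uniq-v v≡ t₀≡ (∈-spliced⁻ Pu u≡ refl x∈u x≢a)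

    a∉v : a m ∉ v
    a∉v a∈v = removed-∉ Pu uniq-u u≡ refl (∈-spliced⁻ Pv v≡ t₀≡ a∈v a≢x)

    x∉t₀ : x k ∉ t₀
    x∉t₀ = x∉u ∘ ∈-spliced⁺ Pu refl u≡

    mid₀ : Mid u v t₀
    mid₀ = (su , s₀ , inj₁ (Pu , Su , m , u≡ , refl)) , (s₀ , sv , inj₂ (Pv , Sv , k , t₀≡ , v≡))
      where
      s₀ : IsShuffle t₀
      s₀ = IsShuffle-remove Pu u≡ refl su

    labels₀ : LabelPair H u t₀ v l (x k)
    labels₀ = deletion-hasLabel H Pu Su m u≡ refl uniq-u , lab-x k (Pv , Sv , t₀≡ , v≡)

    l≢x : l ≢ x k
    l≢x l≡x with labelAfter-cases (H ∷ʳ u) (last Pu) (a m)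
    ... | inj₁ l≡a = a≢x (trans (sym l≡a) l≡x)
    ... | inj₂ (k' , last≡ , l≡x')
      with refl ← trans (sym l≡x') l≡x = x∉u (subst (_ ∈_) (sym u≡) (∈-++⁺ˡ (last≡just⇒∈ Pu last≡)))

    classify : ∀ {t} → Mid u v t →
               t ≡ t₀ ⊎ (∃ λ P → ∃₂ λ Mw S → XAfterA m k u v t P Mw S) ⊎ (∃ λ R → ∃₂ λ Mw Q → XBeforeA m k u v t R Mw Q)
    classify (r₁ , r₂) with step r₁
    ... | deletion p q m' u≡′ t≡ with m' ≟ m
    ...   | yes refl = inj₁ (removed-unique p Pu uniq-u u≡′ t≡ u≡ refl)
    ...   | no m'≢m  = contradiction (a∈-⋖⁻ r₂ (u⊆v (spliced-∈ p u≡′) (m'≢m ∘ a-injective))) (removed-∉ p uniq-u u≡′ t≡)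
    classify (r₁ , r₂) | insertion p q k' u≡′ t≡ with k' ≟ k
    ...   | no k'≢k  = contradiction (v⊆u (x∈-⋖ r₂ (spliced-∈ p t≡)) (k'≢k ∘ x-injective))
                                     (removed-∉ p (IsShuffle.distinct (proj₁ r₂)) t≡ u≡′)
    ...   | yes refl with step r₂
    ...     | insertion p₂ q₂ _ t≡₂ v≡₂ =
              contradiction (∈-spliced⁺ p₂ t≡₂ v≡₂ (∈-spliced⁺ p u≡′ t≡ (spliced-∈ Pu u≡))) a∉v
    ...     | deletion p₂ q₂ m'' t≡₂ v≡₂ with m'' ≟ m
    ...       | no m''≢m = contradiction (u⊆v (a∈-⋖⁻ r₁ (spliced-∈ p₂ t≡₂)) (m''≢m ∘ a-injective))
                                         (removed-∉ p₂ (IsShuffle.distinct (proj₁ r₂)) t≡₂ v≡₂)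
    ...       | yes refl with splice-order p q p₂ q₂ (trans (sym t≡) t≡₂) x≢a
    ...         | inj₁ (Mw , refl , refl) =
                    inj₂ (inj₂ (p , Mw , q₂ , x-before-a u≡′ (trans v≡₂ (++-assoc p (x k ∷ Mw) q₂)) t≡))
    ...         | inj₂ (Mw , refl , refl) =
                    inj₂ (inj₁ (p₂ , Mw , q , x-after-a (trans u≡′ (++-assoc p₂ (a m ∷ Mw) q)) v≡₂ t≡₂))

    XAfterA-unique : ∀ {t t' P Mw S P' Mw' S'} → XAfterA m k u v t P Mw S → XAfterA m k u v t' P' Mw' S' → t ≡ t'
    XAfterA-unique {P = P} {Mw} {S} {P'} {Mw'} {S'} (x-after-a u≡₁ v≡₁ refl) (x-after-a u≡₂ v≡₂ refl)
      with refl , _ ← splice-position P P' uniq-u u≡₁ u≡₂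
      with PMw≡ , refl ← splice-position (P ++ Mw) (P' ++ Mw') uniq-v (reassoc P Mw v≡₁) (reassoc P' Mw' v≡₂)
      with refl ← ++-cancelˡ P Mw Mw' PMw≡ = refl

    XBeforeA-unique : ∀ {t t' R Mw Q R' Mw' Q'} → XBeforeA m k u v t R Mw Q → XBeforeA m k u v t' R' Mw' Q' → t ≡ t'
    XBeforeA-unique {R = R} {Mw} {Q} {R'} {Mw'} {Q'} (x-before-a u≡₁ v≡₁ refl) (x-before-a u≡₂ v≡₂ refl)
      with refl , _ ← splice-position R R' uniq-v v≡₁ v≡₂
      with RMw≡ , refl ← splice-position (R ++ Mw) (R' ++ Mw') uniq-u (reassoc R Mw u≡₁) (reassoc R' Mw' u≡₂)
      with refl ← ++-cancelˡ R Mw Mw' RMw≡ = refl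

    XAfterA-XBeforeA-adjacent : ∀ {t t' P Mw S R Mw' Q} → XAfterA m k u v t P Mw S → XBeforeA m k u v t' R Mw' Q →
                                Mw ≡ [] × Mw' ≡ []
    XAfterA-XBeforeA-adjacent {P = P} {Mw} {S} {R} {Mw'} {Q} (x-after-a u≡₁ v≡₁ _) (x-before-a u≡₂ v≡₂ _)
      with P≡ , _ ← splice-position P (R ++ Mw') uniq-u u≡₁ (reassoc R Mw' u≡₂)
         | PMw≡ , _ ← splice-position (P ++ Mw) R uniq-v (reassoc P Mw v≡₁) v≡₂ =
      ++-conicalˡ Mw Mw' Mw++Mw'≡[] , ++-conicalʳ Mw Mw' Mw++Mw'≡[]
      where
      Mw++Mw'≡[] : Mw ++ Mw' ≡ []
      Mw++Mw'≡[] = ++-identityʳ-unique P (trans P≡ (trans (cong (_++ Mw') (sym PMw≡)) (++-assoc P Mw Mw')))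

    XAfterA-mid : ∀ {t P Mw S} → XAfterA m k u v t P Mw S → Mid u v t
    XAfterA-mid {t} {P} {Mw} (x-after-a u≡₁ v≡₁ t≡₁) =
      (su , st , inj₂ (P ++ a m ∷ Mw , _ , k , reassoc P (a m ∷ Mw) u≡₁ , reassoc P (a m ∷ Mw) t≡₁)) ,
      (st , sv , inj₁ (P , _ , m , t≡₁ , v≡₁))
      where
      st : IsShuffle t
      st = IsShuffle-between (P ++ a m ∷ Mw) P (reassoc P (a m ∷ Mw) u≡₁) (reassoc P (a m ∷ Mw) t≡₁) t≡₁ v≡₁ su sv x∉u

    XBeforeA-mid : ∀ {t R Mw Q} → XBeforeA m k u v t R Mw Q → Mid u v t
    XBeforeA-mid {t} {R} {Mw} (x-before-a u≡₁ v≡₁ t≡₁) =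
      (su , st , inj₂ (R , _ , k , u≡₁ , t≡₁)) ,
      (st , sv , inj₁ (R ++ x k ∷ Mw , _ , m , reassoc R (x k ∷ Mw) t≡₁ , reassoc R (x k ∷ Mw) v≡₁))
      where
      st : IsShuffle t
      st = IsShuffle-between R (R ++ x k ∷ Mw) u≡₁ t≡₁ (reassoc R (x k ∷ Mw) t≡₁) (reassoc R (x k ∷ Mw) v≡₁) su sv x∉u

    insertion-first-≢t₀ : ∀ {t} p {q} → t ≡ p ++ x k ∷ q → t₀ ≢ t
    insertion-first-≢t₀ p t≡ t₀≡t = x∉t₀ (subst (_ ∈_) (sym t₀≡t) (spliced-∈ p t≡))

    XAfterA-labels : ∀ {t P Mw S} → XAfterA m k u v t P Mw S → LabelPair H u t v (x k) l
    XAfterA-labels {t} {P} {Mw} {S} sh@(x-after-a u≡₁ v≡₁ t≡₁) =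
      lab-x k (P ++ a m ∷ Mw , _ , u≡′ , t≡′) ,
      subst (HasLabel _ t v) second≡ (deletion-hasLabel (H ∷ʳ u) P _ m t≡₁ v≡₁ uniq-t)
      where
      u≡′ : u ≡ (P ++ a m ∷ Mw) ++ S
      u≡′ = reassoc P (a m ∷ Mw) u≡₁
      t≡′ : t ≡ (P ++ a m ∷ Mw) ++ x k ∷ S
      t≡′ = reassoc P (a m ∷ Mw) t≡₁
      uniq-t : Unique t
      uniq-t = IsShuffle.distinct (proj₁ (proj₂ (proj₁ (XAfterA-mid sh))))
      second≡ : deletionLabel ((H ∷ʳ u) ∷ʳ t) P m ≡ l
      second≡ = trans (labelAfter-∷ʳ H (last P) (a m) λ _ → insertion-¬delAfter (P ++ a m ∷ Mw) u≡′ t≡′)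
                      (cong (λ p → deletionLabel (H ∷ʳ u) p m) (proj₁ (splice-position P Pu uniq-u u≡₁ u≡)))

    XBeforeA-labels : ∀ {t R e Mw Q} → XBeforeA m k u v t R (e ∷ Mw) Q → LabelPair H u t v (x k) l
    XBeforeA-labels {t} {R} {e} {Mw} sh@(x-before-a u≡₁ v≡₁ t≡₁) =
      lab-x k (R , _ , u≡₁ , t≡₁) ,
      subst (HasLabel _ t v) second≡
        (deletion-hasLabel (H ∷ʳ u) (R ++ x k ∷ e ∷ Mw) _ m
          (reassoc R (x k ∷ e ∷ Mw) t≡₁) (reassoc R (x k ∷ e ∷ Mw) v≡₁) uniq-t)
      where
      open ≡-Reasoning
      uniq-t : Unique t
      uniq-t = IsShuffle.distinct (proj₁ (proj₂ (proj₁ (XBeforeA-mid sh))))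
      second≡ : deletionLabel ((H ∷ʳ u) ∷ʳ t) (R ++ x k ∷ e ∷ Mw) m ≡ l
      second≡ = begin
        labelAfter ((H ∷ʳ u) ∷ʳ t) (last (R ++ x k ∷ e ∷ Mw)) (a m)  ≡⟨ cong (λ y → labelAfter _ y (a m)) (last-++-∷ R) ⟩
        labelAfter ((H ∷ʳ u) ∷ʳ t) (last (e ∷ Mw)) (a m)
          ≡⟨ labelAfter-∷ʳ H (last (e ∷ Mw)) (a m) (λ _ → insertion-¬delAfter R u≡₁ t≡₁) ⟩
        labelAfter (H ∷ʳ u) (last (e ∷ Mw)) (a m)                    ≡⟨ cong (λ y → labelAfter _ y (a m)) (last-++-∷ R) ⟨
        deletionLabel (H ∷ʳ u) (R ++ e ∷ Mw) m
          ≡⟨ cong (λ p → deletionLabel (H ∷ʳ u) p m)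
                  (proj₁ (splice-position (R ++ e ∷ Mw) Pu uniq-u (reassoc R (e ∷ Mw) u≡₁) u≡)) ⟩
        l                                                            ∎

    XBeforeA-adjacent-labels : ∀ {t R Q} → XBeforeA m k u v t R [] Q → (x k ∉ u → All (x k ∉_) (H ∷ʳ u)) →
                               LabelPair H u t v (x k) (x k)
    XBeforeA-adjacent-labels {R = R} (x-before-a u≡₁ v≡₁ t≡₁) fresh =
      lab-x k (R , _ , u≡₁ , t≡₁) , lab-xa k (R , _ , m , t≡₁ , v≡₁) (noDelAfter-absent (H ∷ʳ u) (fresh x∉u))

  deletion-insertion-adjacent : ∀ H P S m k → IsShuffle (P ++ a m ∷ S) → IsShuffle (P ++ x k ∷ S) →
                                (x k ∉ P ++ a m ∷ S → All (x k ∉_) (H ∷ʳ (P ++ a m ∷ S))) →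
                                LabelledΠ₃ H (P ++ a m ∷ S) (P ++ x k ∷ S)
  deletion-insertion-adjacent H P S m k su sv fresh =
    t₁ , t₀ , t₃ , t₀≢t₁ ∘ sym , t₁≢t₃ , insertion-first-≢t₀ P refl ,
    XAfterA-mid shape₁ , mid₀ , XBeforeA-mid shape₃ , cover ,
    k , l , l≢x , XAfterA-labels shape₁ , labels₀ , XBeforeA-adjacent-labels shape₃ fresh
    where
    open DeletionInsertion H su sv P S P S refl refl refl
    t₁ t₃ : Word
    t₁ = P ++ a m ∷ x k ∷ S
    t₃ = P ++ x k ∷ a m ∷ S
    shape₁ : XAfterA m k _ _ t₁ P [] S
    shape₁ = x-after-a refl refl refl
    shape₃ : XBeforeA m k _ _ t₃ P [] S
    shape₃ = x-before-a refl refl refl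
    t₀≢t₁ : t₀ ≢ t₁
    t₀≢t₁ = insertion-first-≢t₀ (P ++ [ a m ]) (sym (++-assoc P [ a m ] (x k ∷ S)))
    t₁≢t₃ : t₁ ≢ t₃
    t₁≢t₃ t₁≡t₃ = a≢x (∷-injectiveˡ (++-cancelˡ P _ _ t₁≡t₃))
    cover : ∀ t → Mid _ _ t → t ≡ t₁ ⊎ t ≡ t₀ ⊎ t ≡ t₃
    cover t mid-t with classify mid-t
    ... | inj₁ t≡                      = inj₂ (inj₁ t≡)
    ... | inj₂ (inj₁ (_ , _ , _ , sh)) = inj₁ (XAfterA-unique sh shape₁)
    ... | inj₂ (inj₂ (_ , _ , _ , sh)) = inj₂ (inj₂ (XBeforeA-unique sh shape₃))

  deletion-insertion-XAfterA : ∀ H P e Mw S m k → IsShuffle (P ++ a m ∷ e ∷ Mw ++ S) → IsShuffle (P ++ e ∷ Mw ++ x k ∷ S) →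
                               LabelledC₂×C₂ H (P ++ a m ∷ e ∷ Mw ++ S) (P ++ e ∷ Mw ++ x k ∷ S)
  deletion-insertion-XAfterA H P e Mw S m k su sv =
    t₀ , t₁ , insertion-first-≢t₀ (P ++ a m ∷ e ∷ Mw) (sym (++-assoc P (a m ∷ e ∷ Mw) (x k ∷ S))) ,
    mid₀ , XAfterA-mid shape , cover ,
    l , x k , l≢x , labels₀ , XAfterA-labels shape
    where
    open DeletionInsertion H su sv P (e ∷ Mw ++ S) (P ++ e ∷ Mw) S
                      refl (sym (++-assoc P (e ∷ Mw) _)) (sym (++-assoc P (e ∷ Mw) S))
    t₁ : Word
    t₁ = P ++ a m ∷ e ∷ Mw ++ x k ∷ S
    shape : XAfterA m k _ _ t₁ P (e ∷ Mw) S
    shape = x-after-a refl refl refl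
    cover : ∀ t → Mid _ _ t → t ≡ t₀ ⊎ t ≡ t₁
    cover t mid-t with classify mid-t
    ... | inj₁ t≡                      = inj₁ t≡
    ... | inj₂ (inj₁ (_ , _ , _ , sh)) = inj₂ (XAfterA-unique sh shape)
    ... | inj₂ (inj₂ (_ , _ , _ , sh)) = contradiction (proj₁ (XAfterA-XBeforeA-adjacent shape sh)) λ ()

  deletion-insertion-XBeforeA : ∀ H R e Mw Q m k → IsShuffle (R ++ e ∷ Mw ++ a m ∷ Q) → IsShuffle (R ++ x k ∷ e ∷ Mw ++ Q) →
                                LabelledC₂×C₂ H (R ++ e ∷ Mw ++ a m ∷ Q) (R ++ x k ∷ e ∷ Mw ++ Q)
  deletion-insertion-XBeforeA H R e Mw Q m k su sv =
    t₀ , t₁ , insertion-first-≢t₀ R refl ,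
    mid₀ , XBeforeA-mid shape , cover ,
    l , x k , l≢x , labels₀ , XBeforeA-labels shape
    where
    open DeletionInsertion H su sv (R ++ e ∷ Mw) Q R (e ∷ Mw ++ Q)
                      (sym (++-assoc R (e ∷ Mw) _)) refl (++-assoc R (e ∷ Mw) Q)
    t₁ : Word
    t₁ = R ++ x k ∷ e ∷ Mw ++ a m ∷ Q
    shape : XBeforeA m k _ _ t₁ R (e ∷ Mw) Q
    shape = x-before-a refl refl refl
    cover : ∀ t → Mid _ _ t → t ≡ t₀ ⊎ t ≡ t₁
    cover t mid-t with classify mid-t
    ... | inj₁ t≡                      = inj₁ t≡
    ... | inj₂ (inj₂ (_ , _ , _ , sh)) = inj₂ (XBeforeA-unique sh shape)
    ... | inj₂ (inj₁ (_ , _ , _ , sh)) = contradiction (proj₂ (XAfterA-XBeforeA-adjacent sh shape)) λ ()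

  -- The four kinds of two-step chains

  Outcome : List Word → Word → Word → Set
  Outcome H u v = IsShuffle u → IsShuffle v → (∀ {k} → x k ∉ u → All (x k ∉_) (H ∷ʳ u)) →
                  LabelledC₂×C₂ H u v ⊎ LabelledΠ₃ H u v

  Outcome-resp : ∀ {H u u' v v'} → u ≡ u' → v ≡ v' → Outcome H u' v' → Outcome H u v
  Outcome-resp refl refl outcome = outcome

  two-step-outcome : ∀ H {u t v} → Step u t → Step t v → Outcome H u v
  two-step-outcome H (deletion p q m refl refl) (deletion p' q' m' t≡ refl) with ++-equidivisible p q p' (a m' ∷ q') t≡
  ... | inj₁ (Mw , refl , refl) = Outcome-resp refl (++-assoc p Mw q') λ su sv _ → inj₁ (two-deletions H p Mw q' m m' su sv)
  ... | inj₂ ([] , refl , refl) = Outcome-resp (cong (_++ a m ∷ a m' ∷ q') (++-identityʳ p')) refl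
                                    λ su sv _ → inj₁ (two-deletions H p' [] q' m m' su sv)
  ... | inj₂ (_ ∷ Mw , refl , eq) with refl , refl ← ∷-injective eq =
    Outcome-resp (++-assoc p' (a m' ∷ Mw) (a m ∷ q)) refl λ su sv _ → inj₁ (two-deletions H p' Mw q m' m su sv)
  two-step-outcome H (insertion p q k refl refl) (insertion p' q' k' t≡ refl) with ++-equidivisible p (x k ∷ q) p' q' t≡
  ... | inj₁ ([] , refl , refl) = Outcome-resp refl (cong (_++ x k' ∷ x k ∷ q) (++-identityʳ p))
                                    λ su sv _ → inj₁ (two-insertions H p [] q k' k su sv)
  ... | inj₁ (_ ∷ Mw , refl , eq) with refl , refl ← ∷-injective eq =
    Outcome-resp refl (++-assoc p (x k ∷ Mw) (x k' ∷ q')) λ su sv _ → inj₁ (two-insertions H p Mw q' k k' su sv)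
  two-step-outcome H (insertion p q k refl refl) (insertion p' q' k' t≡ refl) | inj₂ (Mw , refl , refl) =
    Outcome-resp (++-assoc p' Mw q) refl λ su sv _ → inj₁ (two-insertions H p' Mw q k' k su sv)
  two-step-outcome H (deletion p q m refl refl) (insertion p' q' k t≡ refl) with ++-equidivisible p q p' q' t≡
  ... | inj₁ ([] , refl , refl) = Outcome-resp refl (cong (_++ x k ∷ q') (++-identityʳ p))
                                    λ su sv fresh → inj₂ (deletion-insertion-adjacent H p q' m k su sv fresh)
  ... | inj₁ (e ∷ Mw , refl , refl) = Outcome-resp refl (++-assoc p (e ∷ Mw) (x k ∷ q'))
                                        λ su sv _ → inj₁ (deletion-insertion-XAfterA H p e Mw q' m k su sv)
  ... | inj₂ ([] , refl , refl) = Outcome-resp (cong (_++ a m ∷ q) (++-identityʳ p')) refl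
                                    λ su sv fresh → inj₂ (deletion-insertion-adjacent H p' q m k su sv fresh)
  ... | inj₂ (e ∷ Mw , refl , refl) = Outcome-resp (++-assoc p' (e ∷ Mw) (a m ∷ q)) refl
                                        λ su sv _ → inj₁ (deletion-insertion-XBeforeA H p' e Mw q m k su sv)
  two-step-outcome H (insertion p q k refl refl) (deletion p' q' m t≡ refl) with splice-order p q p' q' t≡ x≢a
  ... | inj₁ ([] , refl , refl) = Outcome-resp refl (++-assoc p [ x k ] q')
                                    λ su sv fresh → inj₂ (deletion-insertion-adjacent H p q' m k su sv fresh)
  ... | inj₁ (e ∷ Mw , refl , refl) = Outcome-resp refl (++-assoc p (x k ∷ e ∷ Mw) q')
                                        λ su sv _ → inj₁ (deletion-insertion-XBeforeA H p e Mw q' m k su sv)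
  ... | inj₂ ([] , refl , refl) = Outcome-resp (++-assoc p' [ a m ] q) refl
                                    λ su sv fresh → inj₂ (deletion-insertion-adjacent H p' q m k su sv fresh)
  ... | inj₂ (e ∷ Mw , refl , refl) = Outcome-resp (++-assoc p' (a m ∷ e ∷ Mw) q) refl
                                        λ su sv _ → inj₁ (deletion-insertion-XAfterA H p' e Mw q m k su sv)

lemma3p2 : (M N : ℕ) → let open Shuffle M N in
    (u v : Word) → IsShuffle u → IsShuffle v → u ≤ v → u ≢ v → ρ v ≡ ρ u + 2 →
    (κ : 0̂ ≤ u) →
    ( IntervalIso u v C₂×C₂ _⊑₂₂_ ×
      Σ Word (λ t₁ → Σ Word λ t₂ → t₁ ≢ t₂ × Mid u v t₁ × Mid u v t₂ ×
        (∀ t → Mid u v t → t ≡ t₁ ⊎ t ≡ t₂) ×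
        Σ Letter λ l₁ → Σ Letter λ l₂ → l₁ ≢ l₂ ×
          LabelPair (vertices κ) u t₁ v l₁ l₂ × LabelPair (vertices κ) u t₂ v l₂ l₁) )
    ⊎
    ( IntervalIso u v Π₃ _⊑Π_ ×
      Σ Word (λ t₁ → Σ Word λ t₂ → Σ Word λ t₃ →
        t₁ ≢ t₂ × t₁ ≢ t₃ × t₂ ≢ t₃ ×
        Mid u v t₁ × Mid u v t₂ × Mid u v t₃ ×
        (∀ t → Mid u v t → t ≡ t₁ ⊎ t ≡ t₂ ⊎ t ≡ t₃) ×
        Σ (Fin N) λ j → Σ Letter λ l → l ≢ x j ×
          LabelPair (vertices κ) u t₁ v (x j) l ×
          LabelPair (vertices κ) u t₂ v l (x j) ×
          LabelPair (vertices κ) u t₃ v (x j) (x j)) )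
lemma3p2 M N u v su sv u≤v@(r₁ ◅ r₂ ◅ ε) _ ρv κ =
  Sum.map (λ c → with-C₂×C₂-iso c , c) (λ c → with-Π₃-iso c , c)
          (two-step-outcome (vertices κ) (step r₁) (step r₂) su sv (vertices-x∉ κ))
  where
  open Shuffle M N
  open ShuffleProperties M N
  with-C₂×C₂-iso : LabelledC₂×C₂ (vertices κ) u v → IntervalIso u v C₂×C₂ _⊑₂₂_
  with-C₂×C₂-iso (_ , _ , t₁≢t₂ , mid₁ , mid₂ , cover , _) = intervalIso-C₂×C₂ ρv u≤v t₁≢t₂ mid₁ mid₂ cover
  with-Π₃-iso : LabelledΠ₃ (vertices κ) u v → IntervalIso u v Π₃ _⊑Π_
  with-Π₃-iso (_ , _ , _ , t₁≢t₂ , t₁≢t₃ , t₂≢t₃ , mid₁ , mid₂ , mid₃ , cover , _) =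
    intervalIso-Π₃ ρv u≤v t₁≢t₂ t₁≢t₃ t₂≢t₃ mid₁ mid₂ mid₃ cover
lemma3p2 M N u v su sv ε                     u≢v _  _ = contradiction refl u≢v
lemma3p2 M N u v su sv u≤v@(_ ◅ ε)           _   ρv _ = contradiction (ShuffleProperties.chainLengths≡2 M N ρv ε u≤v) λ ()
lemma3p2 M N u v su sv u≤v@(_ ◅ _ ◅ _ ◅ _)   _   ρv _ = contradiction (ShuffleProperties.chainLengths≡2 M N ρv ε u≤v) λ ()
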